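{- Let $2\le i<j\le s$ and let $\mu=(\mu_1,\dots,\mu_s)\vdash n$ with $\mu_{i-1}>\mu_i$, and with $\mu_j>\mu_{j+1}$ if $j<s$. Then $f(\mu(i,j))\ge f(\mu)$, with equality if and only if $\mu\in\mathcal{P}^*_{n,3}$ and $\mu_i=1$.
   Context: Partitions are non-increasing sequences of positive integers; $\lambda\vdash n$ means the parts sum to $n$. For $\lambda=(\lambda_1,\dots,\lambda_r)$: $\lambda\setminus\lambda_r:=(\lambda_1,\dots,\lambda_{r-1})$; for $1\le k\le\lambda_r$, $\lambda-\hat{k}:=(\lambda_1-k,\dots,\lambda_r-k)$; zero parts are deleted and the all-zero sequence is identified with $(0)$. For $\mu$ as in the claim, $\mu(i,j)$ is the partition obtained from $\mu$ by replacing $\mu_i$ by $\mu_i+1$ and $\mu_j$ by $\mu_j-1$ (deleting the part if it becomes $0$). $\mathcal{P}^*_{n,3}$ is the set of partitions $(\mu_1,\dots,\mu_r)\vdash n$ with $\mu_1=3$ and $1\le\mu_2\le2$ whenever $r\ge2$. Define $d_0=1$, $d_1=0$, $d_n=2(n-1)(d_{n-1}+d_{n-2})$ for $n\ge2$. Define $f$ on partitions recursively: $f((0))=1$; $f((n))=d_n$ for $n\ge1$; and for $\lambda=(\lambda_1,\dots,\lambda_r)$ with $r\ge2$, $f(\lambda)=f(\lambda\setminus\lambda_r)+\sum_{k=1}^{\lambda_r}\binom{\lambda_r}{k}(2k-1)!!\,f(\lambda\setminus\lambda_r-\hat{k})$. -}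

module Defs where

open import Data.Nat using (ℕ; zero; suc; _+_; _*_; _∸_; _≤_; _<_; _>_)
open import Data.Nat.Combinatorics using (_C_)
open import Data.List using (List; []; _∷_; map; filter; length)
open import Data.Nat.ListAction using (sum)
open import Data.List.Relation.Unary.All using (All)
open import Data.List.Relation.Unary.Linked using (Linked)
open import Data.Nat.Properties using (_≟_)
open import Relation.Nullary using (¬?)
open import Data.Product using (_×_)
open import Relation.Binary.PropositionalEquality using (_≡_)

d : ℕ → ℕ
d zero = 1
d (suc zero) = 0
d (suc (suc n)) = 2 * suc n * (d (suc n) + d n)

oddDF : ℕ → ℕ
oddDF zero = 1
oddDF (suc k) = (2 * k + 1) * oddDF k

-- Partitions are lists of parts; the empty list plays the role of (0).
IsPartition : List ℕ → Set
IsPartition μ = All (0 <_) μ × Linked (λ a b → b ≤ a) μ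

_⊢_ : List ℕ → ℕ → Set
μ ⊢ n = IsPartition μ × sum μ ≡ n

dropZeros : List ℕ → List ℕ
dropZeros = filter (λ x → ¬? (x ≟ 0))

dropLast : List ℕ → List ℕ
dropLast [] = []
dropLast (x ∷ []) = []
dropLast (x ∷ y ∷ ys) = x ∷ dropLast (y ∷ ys)

-- λ_r (the last part; 0 for the empty list)
lastPart : List ℕ → ℕ
lastPart [] = 0
lastPart (x ∷ []) = x
lastPart (x ∷ y ∷ ys) = lastPart (y ∷ ys)

minusHat : List ℕ → ℕ → List ℕ
minusHat λ′ k = dropZeros (map (_∸ k) λ′)

sumFrom1 : ℕ → (ℕ → ℕ) → ℕ
sumFrom1 zero g = 0
sumFrom1 (suc m) g = sumFrom1 m g + g (suc m)

-- recursion for f, with fuel (f uses fuel = number of parts, which suffices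
-- since each recursive call is on a list with one fewer part at most)
fFuel : ℕ → List ℕ → ℕ
fFuel _ [] = 1
fFuel _ (x ∷ []) = d x
fFuel zero (x ∷ y ∷ ys) = 0
fFuel (suc m) (x ∷ y ∷ ys) =
  fFuel m (dropLast (x ∷ y ∷ ys))
  + sumFrom1 r (λ k → (r C k) * oddDF k * fFuel m (minusHat (dropLast (x ∷ y ∷ ys)) k))
  where r = lastPart (x ∷ y ∷ ys)

f : List ℕ → ℕ
f μ = fFuel (length μ) μ

-- 1-based access μ_k (0 if out of range)
at : List ℕ → ℕ → ℕ
at [] _ = 0
at (x ∷ xs) zero = 0
at (x ∷ xs) (suc zero) = x
at (x ∷ xs) (suc (suc k)) = at xs (suc k)

modifyAt : ℕ → (ℕ → ℕ) → List ℕ → List ℕ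
modifyAt _ g [] = []
modifyAt zero g xs = xs
modifyAt (suc zero) g (x ∷ xs) = g x ∷ xs
modifyAt (suc (suc k)) g (x ∷ xs) = x ∷ modifyAt (suc k) g xs

shift : List ℕ → ℕ → ℕ → List ℕ
shift μ i j = dropZeros (modifyAt j (_∸ 1) (modifyAt i suc μ))

PStar3 : ℕ → List ℕ → Set
PStar3 n μ = μ ⊢ n × at μ 1 ≡ 3 × (2 ≤ length μ → 1 ≤ at μ 2 × at μ 2 ≤ 2)

module Submission where

-- Write λ′ for the conjugate of a partition λ. Unfolding the recursion for f one part at a time
-- gives f λ = Σ_χ d(|χ⁻¹ 1|) · ∏_{c ≥ 2} (2|χ⁻¹ c| − 1)!!, where χ runs over the ways to give every
-- column t a colour 1 ≤ χ t ≤ λ′_t. The sum does not depend on the order of the columns, and the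
-- conjugates of μ and μ(i,j) differ only in two columns, of heights (j, i − 1) for μ and (j − 1, i)
-- for μ(i,j). Matching colourings of these two columns, each colouring of μ is paired with one of
-- μ(i,j) whose colour counts at (i, j) majorize the old ones, with the larger count at i; since
-- (2a − 1)!! (2b − 1)!! grows as (a, b) is spread apart, no weight decreases. Among the unmatched
-- colourings of μ(i,j) are those giving both special columns the colour i; they contribute E ≥ 0.
-- E vanishes only if the remaining columns form a single cell (otherwise some colouring avoids the
-- factor d 1 = 0), which happens exactly for μ ∈ 𝒫*_{n,3} with μ_i = 1.

open import Defs
import Algebra.Properties.CommutativeSemigroup as CommSemigroupProperties
open import Data.List using (List; []; _∷_; _++_; map; length; replicate)
open import Data.List.Properties using (length-map; length-filter; ++-assoc)
open import Data.List.Relation.Binary.Permutation.Propositional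
  using (_↭_; ↭-reflexive) renaming (refl to ↭-refl; prep to ↭-prep; swap to ↭-swap; trans to ↭-trans)
open import Data.List.Relation.Binary.Permutation.Propositional.Properties using () renaming (shift to ↭-shift)
open import Data.List.Relation.Unary.All as All using (All; []; _∷_)
open import Data.List.Relation.Unary.All.Properties as AllP using (¬Any⇒All¬)
open import Data.List.Relation.Unary.Any using (Any; here; there)
open import Data.List.Relation.Unary.Linked as Linked using (Linked; []; [-]; _∷_)
import Data.List.Relation.Unary.Linked.Properties as Linked
open import Data.Nat using (ℕ; zero; suc; _+_; _*_; _∸_; _≤_; _<_; _>_; z≤n; s≤s; s≤s⁻¹; >-nonZero)
open import Data.Nat.Combinatorics using (_C_; nCk+nC[k+1]≡[n+1]C[k+1]; k>n⇒nCk≡0)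
open import Data.Nat.ListAction using (sum)
open import Data.Nat.Properties
open import Data.Nat.Tactic.RingSolver using (solve-∀)
open import Data.Product using (_×_; _,_; Σ; proj₂)
open import Data.Sum using (_⊎_; inj₁; inj₂)
open import Function.Base using (_∘_)
open import Function.Bundles using (_⇔_; mk⇔)
open import Relation.Binary.PropositionalEquality
open import Relation.Nullary using (yes; no; ¬_; ¬?; contradiction)

private
  module +-CS = CommSemigroupProperties +-commutativeSemigroup
  module *-CS = CommSemigroupProperties *-commutativeSemigroup

-- Finite sums

sumFrom1-cong : ∀ l {g h : ℕ → ℕ} → (∀ c → 1 ≤ c → c ≤ l → g c ≡ h c) →
  sumFrom1 l g ≡ sumFrom1 l h
sumFrom1-cong zero    e = refl
sumFrom1-cong (suc l) e =
  cong₂ _+_ (sumFrom1-cong l λ c p q → e c p (m≤n⇒m≤1+n q)) (e (suc l) (s≤s z≤n) ≤-refl)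

sumFrom1-mono-≤ : ∀ l {g h : ℕ → ℕ} → (∀ c → 1 ≤ c → c ≤ l → g c ≤ h c) →
  sumFrom1 l g ≤ sumFrom1 l h
sumFrom1-mono-≤ zero    e = z≤n
sumFrom1-mono-≤ (suc l) e =
  +-mono-≤ (sumFrom1-mono-≤ l λ c p q → e c p (m≤n⇒m≤1+n q)) (e (suc l) (s≤s z≤n) ≤-refl)

sumFrom1-+ : ∀ l (g h : ℕ → ℕ) → sumFrom1 l (λ c → g c + h c) ≡ sumFrom1 l g + sumFrom1 l h
sumFrom1-+ zero    g h = refl
sumFrom1-+ (suc l) g h rewrite sumFrom1-+ l g h =
  +-CS.interchange (sumFrom1 l g) (sumFrom1 l h) (g (suc l)) (h (suc l))

sumFrom1-*ˡ : ∀ l a (g : ℕ → ℕ) → sumFrom1 l (λ c → a * g c) ≡ a * sumFrom1 l g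
sumFrom1-*ˡ zero    a g = sym (*-zeroʳ a)
sumFrom1-*ˡ (suc l) a g rewrite sumFrom1-*ˡ l a g = sym (*-distribˡ-+ a (sumFrom1 l g) (g (suc l)))

sumFrom1-zero : ∀ l → sumFrom1 l (λ _ → 0) ≡ 0
sumFrom1-zero zero    = refl
sumFrom1-zero (suc l) = cong (_+ 0) (sumFrom1-zero l)

sumFrom1-comm : ∀ a b (g : ℕ → ℕ → ℕ) →
  sumFrom1 a (λ c → sumFrom1 b (g c)) ≡ sumFrom1 b (λ c′ → sumFrom1 a (λ c → g c c′))
sumFrom1-comm zero    b g = sym (sumFrom1-zero b)
sumFrom1-comm (suc a) b g rewrite sumFrom1-comm a b g =
  sym (sumFrom1-+ b (λ c′ → sumFrom1 a (λ c → g c c′)) (g (suc a)))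

sumFrom1-≥-first : ∀ l (g : ℕ → ℕ) → g 1 ≤ sumFrom1 (suc l) g
sumFrom1-≥-first zero    g = ≤-refl
sumFrom1-≥-first (suc l) g = ≤-trans (sumFrom1-≥-first l g) (m≤m+n _ _)

sumFrom1-≥-second : ∀ l (g : ℕ → ℕ) → g 2 ≤ sumFrom1 (suc (suc l)) g
sumFrom1-≥-second zero    g = m≤n+m _ _
sumFrom1-≥-second (suc l) g = ≤-trans (sumFrom1-≥-second l g) (m≤m+n _ _)

sumFrom1-prefix-≤ : ∀ l a (g : ℕ → ℕ) → a < l → sumFrom1 a g + g (suc a) ≤ sumFrom1 l g
sumFrom1-prefix-≤ (suc l) a g (s≤s a≤l) with a ≟ l
... | yes refl = ≤-refl
... | no a≢l   = ≤-trans (sumFrom1-prefix-≤ l a g (≤∧≢⇒< a≤l a≢l)) (m≤m+n _ _)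

sumFrom1-first-only : ∀ l (g : ℕ → ℕ) → (∀ c → 2 ≤ c → g c ≡ 0) → sumFrom1 (suc l) g ≡ g 1
sumFrom1-first-only zero    g g≡0 = refl
sumFrom1-first-only (suc l) g g≡0
  rewrite sumFrom1-first-only l g g≡0 | g≡0 (suc (suc l)) (s≤s (s≤s z≤n)) = +-identityʳ (g 1)

sumFrom0 : ℕ → (ℕ → ℕ) → ℕ
sumFrom0 m g = g 0 + sumFrom1 m g

sumFrom0-cong : ∀ m {g h : ℕ → ℕ} → (∀ k → k ≤ m → g k ≡ h k) → sumFrom0 m g ≡ sumFrom0 m h
sumFrom0-cong m e = cong₂ _+_ (e 0 z≤n) (sumFrom1-cong m λ k _ k≤m → e k k≤m)

sumFrom1-suc : ∀ m (g : ℕ → ℕ) → sumFrom1 (suc m) g ≡ sumFrom0 m (λ k → g (suc k))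
sumFrom1-suc zero    g = sym (+-identityʳ (g 1))
sumFrom1-suc (suc m) g = trans (cong (_+ g (suc (suc m))) (sumFrom1-suc m g)) (+-assoc (g 1) _ _)

sumFrom0-+ : ∀ m (g h : ℕ → ℕ) → sumFrom0 m (λ k → g k + h k) ≡ sumFrom0 m g + sumFrom0 m h
sumFrom0-+ m g h = begin
  (g 0 + h 0) + sumFrom1 m (λ k → g k + h k)       ≡⟨ cong (g 0 + h 0 +_) (sumFrom1-+ m g h) ⟩
  (g 0 + h 0) + (sumFrom1 m g + sumFrom1 m h)      ≡⟨ +-CS.interchange (g 0) (h 0) _ _ ⟩
  (g 0 + sumFrom1 m g) + (h 0 + sumFrom1 m h)      ∎
  where open ≡-Reasoning

-- Pascal's rule, summed against an arbitrary T.
sumFrom0-binomial-suc : ∀ m (T : ℕ → ℕ) →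
  sumFrom0 (suc m) (λ k → (suc m C k) * T k)
    ≡ sumFrom0 m (λ k → (m C k) * T k) + sumFrom0 m (λ k → (m C k) * T (suc k))
sumFrom0-binomial-suc m T = begin
  t₀ + sumFrom1 (suc m) (λ k → (suc m C k) * T k)
    ≡⟨ cong (t₀ +_) (sumFrom1-suc m _) ⟩
  t₀ + sumFrom0 m (λ k → (suc m C suc k) * T (suc k))
    ≡⟨ cong (t₀ +_) (sumFrom0-cong m λ k _ → pascal k) ⟩
  t₀ + sumFrom0 m (λ k → (m C k) * T (suc k) + (m C suc k) * T (suc k))
    ≡⟨ cong (t₀ +_) (sumFrom0-+ m (λ k → (m C k) * T (suc k)) (λ k → (m C suc k) * T (suc k))) ⟩
  t₀ + (A + sumFrom0 m (λ k → (m C suc k) * T (suc k)))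
    ≡⟨ cong (λ s → t₀ + (A + s)) (sym (sumFrom1-suc m _)) ⟩
  t₀ + (A + (Bs + (m C suc m) * T (suc m)))
    ≡⟨ cong (λ c → t₀ + (A + (Bs + c * T (suc m)))) (k>n⇒nCk≡0 (≤-refl {suc m})) ⟩
  t₀ + (A + (Bs + 0))
    ≡⟨ rearrange t₀ A Bs ⟩
  t₀ + Bs + A  ∎
  where
  open ≡-Reasoning
  t₀ = (m C 0) * T 0
  A  = sumFrom0 m (λ k → (m C k) * T (suc k))
  Bs = sumFrom1 m (λ k → (m C k) * T k)
  pascal : ∀ k → (suc m C suc k) * T (suc k) ≡ (m C k) * T (suc k) + (m C suc k) * T (suc k)
  pascal k = trans (cong (_* T (suc k)) (sym (nCk+nC[k+1]≡[n+1]C[k+1] m k)))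
                   (*-distribʳ-+ (T (suc k)) (m C k) (m C suc k))
  rearrange : ∀ t a b → t + (a + (b + 0)) ≡ t + b + a
  rearrange = solve-∀

zeroAt : ℕ → (ℕ → ℕ) → ℕ → ℕ
zeroAt c g x with x ≟ c
... | yes _ = 0
... | no  _ = g x

zeroAt-≡ : ∀ c g {x} → x ≡ c → zeroAt c g x ≡ 0
zeroAt-≡ c g {x} x≡c with x ≟ c
... | yes _   = refl
... | no x≢c = contradiction x≡c x≢c

zeroAt-≢ : ∀ c g {x} → x ≢ c → zeroAt c g x ≡ g x
zeroAt-≢ c g {x} x≢c with x ≟ c
... | yes x≡c = contradiction x≡c x≢c
... | no _    = refl

zeroAt-mono-≤ : ∀ c {g h : ℕ → ℕ} x → (x ≢ c → g x ≤ h x) → zeroAt c g x ≤ zeroAt c h x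
zeroAt-mono-≤ c x g≤h with x ≟ c
... | yes _   = z≤n
... | no x≢c = g≤h x≢c

zeroAt-congAt : ∀ c {π σ : ℕ → ℕ} x → (x ≢ c → π x ≡ σ x) → zeroAt c π x ≡ zeroAt c σ x
zeroAt-congAt c x e with x ≟ c
... | yes _   = refl
... | no x≢c = e x≢c

sumFrom1-zeroAt : ∀ l c g → 1 ≤ c → c ≤ l → sumFrom1 l g ≡ sumFrom1 l (zeroAt c g) + g c
sumFrom1-zeroAt zero    c g 1≤c c≤0 = contradiction (≤-trans 1≤c c≤0) λ ()
sumFrom1-zeroAt (suc l) c g 1≤c c≤1+l with m≤n⇒m<n∨m≡n c≤1+l
... | inj₂ refl = begin
  sumFrom1 l g + g (suc l)
    ≡⟨ cong (_+ g (suc l)) (sumFrom1-cong l λ x _ x≤l → sym (zeroAt-≢ (suc l) g (<⇒≢ (s≤s x≤l)))) ⟩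
  sumFrom1 l (zeroAt (suc l) g) + g (suc l)
    ≡⟨ cong (_+ g (suc l)) (+-identityʳ _) ⟨
  sumFrom1 l (zeroAt (suc l) g) + 0 + g (suc l)
    ≡⟨ cong (λ y → sumFrom1 l (zeroAt (suc l) g) + y + g (suc l)) (zeroAt-≡ (suc l) g refl) ⟨
  sumFrom1 l (zeroAt (suc l) g) + zeroAt (suc l) g (suc l) + g (suc l)  ∎
  where open ≡-Reasoning
... | inj₁ c<1+l = begin
  sumFrom1 l g + g (suc l)
    ≡⟨ cong (_+ g (suc l)) (sumFrom1-zeroAt l c g 1≤c (s≤s⁻¹ c<1+l)) ⟩
  sumFrom1 l (zeroAt c g) + g c + g (suc l)
    ≡⟨ +-CS.xy∙z≈xz∙y (sumFrom1 l (zeroAt c g)) (g c) (g (suc l)) ⟩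
  sumFrom1 l (zeroAt c g) + g (suc l) + g c
    ≡⟨ cong (λ y → sumFrom1 l (zeroAt c g) + y + g c) (sym (zeroAt-≢ c g (≢-sym (<⇒≢ c<1+l)))) ⟩
  sumFrom1 l (zeroAt c g) + zeroAt c g (suc l) + g c  ∎
  where open ≡-Reasoning

sumFrom1-zeroAt₂ : ∀ l {i j} g → 1 ≤ i → i < j → j ≤ l →
  sumFrom1 l g ≡ sumFrom1 l (zeroAt j (zeroAt i g)) + (g i + g j)
sumFrom1-zeroAt₂ l {i} {j} g 1≤i i<j j≤l = begin
  sumFrom1 l g
    ≡⟨ sumFrom1-zeroAt l i g 1≤i (≤-trans (<⇒≤ i<j) j≤l) ⟩
  sumFrom1 l (zeroAt i g) + g i
    ≡⟨ cong (_+ g i) (sumFrom1-zeroAt l j (zeroAt i g) (≤-trans 1≤i (<⇒≤ i<j)) j≤l) ⟩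
  sumFrom1 l (zeroAt j (zeroAt i g)) + zeroAt i g j + g i
    ≡⟨ cong (λ y → sumFrom1 l (zeroAt j (zeroAt i g)) + y + g i) (zeroAt-≢ i g (≢-sym (<⇒≢ i<j))) ⟩
  sumFrom1 l (zeroAt j (zeroAt i g)) + g j + g i
    ≡⟨ +-CS.xy∙z≈x∙zy (sumFrom1 l (zeroAt j (zeroAt i g))) (g j) (g i) ⟩
  sumFrom1 l (zeroAt j (zeroAt i g)) + (g i + g j)  ∎
  where open ≡-Reasoning

sumFrom1-mono-≤-except₂ : ∀ l {i j} {g h : ℕ → ℕ} → 1 ≤ i → i < j →
  (∀ c → c ≢ i → c ≢ j → g c ≤ h c) → g i ≤ h i → (j ≤ l → g i + g j ≤ h i + h j) →
  sumFrom1 l g ≤ sumFrom1 l h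
sumFrom1-mono-≤-except₂ l {i} {j} {g} {h} 1≤i i<j g≤h gi≤hi pair with j ≤? l | i ≤? l
... | yes j≤l | _ = begin
  sumFrom1 l g                                      ≡⟨ sumFrom1-zeroAt₂ l g 1≤i i<j j≤l ⟩
  sumFrom1 l (zeroAt j (zeroAt i g)) + (g i + g j)  ≤⟨ +-mono-≤ rest (pair j≤l) ⟩
  sumFrom1 l (zeroAt j (zeroAt i h)) + (h i + h j)  ≡⟨ sumFrom1-zeroAt₂ l h 1≤i i<j j≤l ⟨
  sumFrom1 l h                                      ∎
  where
  open ≤-Reasoning
  rest : sumFrom1 l (zeroAt j (zeroAt i g)) ≤ sumFrom1 l (zeroAt j (zeroAt i h))
  rest = sumFrom1-mono-≤ l λ c _ _ →
    zeroAt-mono-≤ j c λ c≢j → zeroAt-mono-≤ i c λ c≢i → g≤h c c≢i c≢j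
... | no j≰l | yes i≤l = begin
  sumFrom1 l g                 ≡⟨ sumFrom1-zeroAt l i g 1≤i i≤l ⟩
  sumFrom1 l (zeroAt i g) + g i  ≤⟨ +-mono-≤ rest gi≤hi ⟩
  sumFrom1 l (zeroAt i h) + h i  ≡⟨ sumFrom1-zeroAt l i h 1≤i i≤l ⟨
  sumFrom1 l h                 ∎
  where
  open ≤-Reasoning
  rest : sumFrom1 l (zeroAt i g) ≤ sumFrom1 l (zeroAt i h)
  rest = sumFrom1-mono-≤ l λ c _ c≤l →
    zeroAt-mono-≤ i c λ c≢i → g≤h c c≢i (λ { refl → j≰l c≤l })
... | no j≰l | no i≰l = sumFrom1-mono-≤ l λ c _ c≤l →
  g≤h c (λ { refl → i≰l c≤l }) (λ { refl → j≰l c≤l })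

-- Colour counts

δ : ℕ → ℕ → ℕ
δ x c with x ≟ c
... | yes _ = 1
... | no  _ = 0

δ-≡ : ∀ {x c} → x ≡ c → δ x c ≡ 1
δ-≡ {x} {c} x≡c with x ≟ c
... | yes _   = refl
... | no x≢c = contradiction x≡c x≢c

δ-≢ : ∀ {x c} → x ≢ c → δ x c ≡ 0
δ-≢ {x} {c} x≢c with x ≟ c
... | yes x≡c = contradiction x≡c x≢c
... | no _    = refl

0̇ : ℕ → ℕ
0̇ _ = 0

incAt : ℕ → (ℕ → ℕ) → ℕ → ℕ
incAt c π x = δ x c + π x

incAt-≡ : ∀ c π {x} → x ≡ c → incAt c π x ≡ suc (π x)
incAt-≡ c π x≡c = cong (_+ _) (δ-≡ x≡c)

incAt-≢ : ∀ c π {x} → x ≢ c → incAt c π x ≡ π x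
incAt-≢ c π x≢c = cong (_+ _) (δ-≢ x≢c)

incAt-cong : ∀ c {π σ : ℕ → ℕ} → (∀ x → π x ≡ σ x) → ∀ x → incAt c π x ≡ incAt c σ x
incAt-cong c e x = cong (δ x c +_) (e x)

incAt-comm : ∀ c c′ π x → incAt c (incAt c′ π) x ≡ incAt c′ (incAt c π) x
incAt-comm c c′ π x = +-CS.x∙yz≈y∙xz (δ x c) (δ x c′) (π x)

addAt : ℕ → ℕ → (ℕ → ℕ) → ℕ → ℕ
addAt c zero    π = π
addAt c (suc k) π = addAt c k (incAt c π)

addAt-cong : ∀ c k {π σ : ℕ → ℕ} → (∀ x → π x ≡ σ x) → ∀ x → addAt c k π x ≡ addAt c k σ x
addAt-cong c zero    e = e
addAt-cong c (suc k) e = addAt-cong c k (incAt-cong c e)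

addAt-≡ : ∀ c k π → addAt c k π c ≡ k + π c
addAt-≡ c zero    π = refl
addAt-≡ c (suc k) π = trans (addAt-≡ c k (incAt c π)) (trans (cong (k +_) (incAt-≡ c π refl)) (+-suc k (π c)))

addAt-≢ : ∀ c k π {x} → x ≢ c → addAt c k π x ≡ π x
addAt-≢ c zero    π x≢c = refl
addAt-≢ c (suc k) π x≢c = trans (addAt-≢ c k (incAt c π) x≢c) (incAt-≢ c π x≢c)

incAt-addAt : ∀ c′ k c π x → incAt c (addAt c′ k π) x ≡ addAt c′ k (incAt c π) x
incAt-addAt c′ zero    c π x = refl
incAt-addAt c′ (suc k) c π x =
  trans (incAt-addAt c′ k c (incAt c′ π) x) (addAt-cong c′ k (incAt-comm c c′ π) x)

-- Weights

oddDF-pos : ∀ n → 1 ≤ oddDF n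
oddDF-pos zero    = ≤-refl
oddDF-pos (suc n) = *-mono-≤ (≤-trans (s≤s z≤n) (≤-reflexive (+-comm 1 (2 * n)))) (oddDF-pos n)

oddDF-ratio-mono : ∀ {x y} → y ≤ x → oddDF x * oddDF (suc y) ≤ oddDF (suc x) * oddDF y
oddDF-ratio-mono {x} {y} y≤x = begin
  oddDF x * ((2 * y + 1) * oddDF y)  ≡⟨ *-CS.x∙yz≈y∙xz (oddDF x) (2 * y + 1) (oddDF y) ⟩
  (2 * y + 1) * (oddDF x * oddDF y)  ≤⟨ *-monoˡ-≤ _ (+-monoˡ-≤ 1 (*-monoʳ-≤ 2 y≤x)) ⟩
  (2 * x + 1) * (oddDF x * oddDF y)  ≡⟨ *-assoc (2 * x + 1) (oddDF x) (oddDF y) ⟨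
  (2 * x + 1) * oddDF x * oddDF y    ∎
  where open ≤-Reasoning

oddDF-spread-≤ : ∀ k {a b} → b + k ≤ a → oddDF a * oddDF (b + k) ≤ oddDF (a + k) * oddDF b
oddDF-spread-≤ zero    {a} {b} _ rewrite +-identityʳ a | +-identityʳ b = ≤-refl
oddDF-spread-≤ (suc k) {a} {b} b+k<a rewrite +-suc a k | +-suc b k = ≤-trans
  (oddDF-ratio-mono (≤-trans (n≤1+n _) b+k<a))
  (oddDF-spread-≤ k (≤-trans (≤-trans (n≤1+n _) b+k<a) (n≤1+n a)))

oddDF-*-spread-≤ : ∀ {a b a′ b′} → a + b ≡ a′ + b′ → b′ ≤ a′ → a′ ≤ a →
  oddDF a′ * oddDF b′ ≤ oddDF a * oddDF b
oddDF-*-spread-≤ {b = b} {a′} {b′} sum≡ b′≤a′ a′≤a with m≤n⇒∃[o]m+o≡n a′≤a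
... | k , refl with +-cancelˡ-≡ a′ b′ (b + k) (trans (sym sum≡) (+-CS.xy∙z≈x∙zy a′ k b))
...   | refl = oddDF-spread-≤ k b′≤a′

oddDF-*-majorization-≤ : ∀ {a b a′ b′} → a + b ≡ a′ + b′ → a′ ≤ a → b′ ≤ a →
  oddDF a′ * oddDF b′ ≤ oddDF a * oddDF b
oddDF-*-majorization-≤ {a} {b} {a′} {b′} sum≡ a′≤a b′≤a with ≤-total b′ a′
... | inj₁ b′≤a′ = oddDF-*-spread-≤ sum≡ b′≤a′ a′≤a
... | inj₂ a′≤b′ = subst (_≤ oddDF a * oddDF b) (*-comm (oddDF b′) (oddDF a′))
  (oddDF-*-spread-≤ (trans sum≡ (+-comm a′ b′)) a′≤b′ b′≤a)

d-pos : ∀ n → n ≢ 1 → 1 ≤ d n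
d-pos zero          _    = ≤-refl
d-pos (suc zero)    n≢1 = contradiction refl n≢1
d-pos (suc (suc n)) _    = *-mono-≤ {1} {2 * suc n} (s≤s z≤n) (sum-pos n)
  where
  sum-pos : ∀ n → 1 ≤ d (suc n) + d n
  sum-pos (suc zero) = s≤s z≤n
  sum-pos n@zero          = ≤-trans (d-pos n (λ ())) (m≤n+m (d n) (d (suc n)))
  sum-pos n@(suc (suc _)) = ≤-trans (d-pos n (λ ())) (m≤n+m (d n) (d (suc n)))

weight : ℕ → ℕ → ℕ
weight (suc zero) = d
weight _          = oddDF

weight-zero : ∀ c → weight c 0 ≡ 1
weight-zero zero          = refl
weight-zero (suc zero)    = refl
weight-zero (suc (suc c)) = refl

weight-≥2 : ∀ {c} x → 2 ≤ c → weight c x ≡ oddDF x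
weight-≥2 {suc (suc c)} x _         = refl
weight-≥2 {suc zero}    x (s≤s ())

weight≡0⇒ : ∀ c x → weight c x ≡ 0 → c ≡ 1 × x ≡ 1
weight≡0⇒ (suc zero) x w≡0 with x ≟ 1
... | yes x≡1 = refl , x≡1
... | no  x≢1 = contradiction w≡0 (≢-sym (<⇒≢ (d-pos x x≢1)))
weight≡0⇒ zero          x w≡0 = contradiction w≡0 (≢-sym (<⇒≢ (oddDF-pos x)))
weight≡0⇒ (suc (suc c)) x w≡0 = contradiction w≡0 (≢-sym (<⇒≢ (oddDF-pos x)))

weightProd : ℕ → (ℕ → ℕ) → ℕ
weightProd zero    π = 1
weightProd (suc B) π = weightProd B π * weight (suc B) (π (suc B))

weightProd-cong : ∀ B {π σ : ℕ → ℕ} → (∀ x → 1 ≤ x → x ≤ B → π x ≡ σ x) →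
  weightProd B π ≡ weightProd B σ
weightProd-cong zero    e = refl
weightProd-cong (suc B) e = cong₂ _*_
  (weightProd-cong B λ x p q → e x p (m≤n⇒m≤1+n q))
  (cong (weight (suc B)) (e (suc B) (s≤s z≤n) ≤-refl))

weightProd-zeroAt : ∀ B {c} π → 2 ≤ c → c ≤ B → weightProd B π ≡ weightProd B (zeroAt c π) * oddDF (π c)
weightProd-zeroAt zero    π 2≤c c≤0 = contradiction (≤-trans 2≤c c≤0) λ ()
weightProd-zeroAt (suc B) {c} π 2≤c c≤1+B with m≤n⇒m<n∨m≡n c≤1+B
... | inj₂ refl = begin
  weightProd B π * weight c (π c)
    ≡⟨ cong₂ _*_ (weightProd-cong B λ x _ x≤B → sym (zeroAt-≢ c π (<⇒≢ (s≤s x≤B)))) (weight-≥2 (π c) 2≤c) ⟩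
  weightProd B (zeroAt c π) * oddDF (π c)
    ≡⟨ cong (_* oddDF (π c)) (*-identityʳ (weightProd B (zeroAt c π))) ⟨
  weightProd B (zeroAt c π) * 1 * oddDF (π c)
    ≡⟨ cong (λ w → weightProd B (zeroAt c π) * w * oddDF (π c))
            (trans (cong (weight c) (zeroAt-≡ c π refl)) (weight-zero c)) ⟨
  weightProd B (zeroAt c π) * weight c (zeroAt c π c) * oddDF (π c)  ∎
  where open ≡-Reasoning
... | inj₁ c<1+B = begin
  weightProd B π * weight (suc B) (π (suc B))
    ≡⟨ cong (_* weight (suc B) (π (suc B))) (weightProd-zeroAt B π 2≤c (s≤s⁻¹ c<1+B)) ⟩
  weightProd B (zeroAt c π) * oddDF (π c) * weight (suc B) (π (suc B))
    ≡⟨ *-CS.xy∙z≈xz∙y (weightProd B (zeroAt c π)) (oddDF (π c)) _ ⟩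
  weightProd B (zeroAt c π) * weight (suc B) (π (suc B)) * oddDF (π c)
    ≡⟨ cong (λ v → weightProd B (zeroAt c π) * weight (suc B) v * oddDF (π c))
            (zeroAt-≢ c π (≢-sym (<⇒≢ c<1+B))) ⟨
  weightProd B (zeroAt c π) * weight (suc B) (zeroAt c π (suc B)) * oddDF (π c)  ∎
  where open ≡-Reasoning

weightProd-zeroAt₂ : ∀ B {i j} π → 2 ≤ i → i < j → j ≤ B →
  weightProd B π ≡ weightProd B (zeroAt j (zeroAt i π)) * (oddDF (π i) * oddDF (π j))
weightProd-zeroAt₂ B {i} {j} π 2≤i i<j j≤B = begin
  weightProd B π
    ≡⟨ weightProd-zeroAt B π 2≤i (≤-trans (<⇒≤ i<j) j≤B) ⟩
  weightProd B (zeroAt i π) * oddDF (π i)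
    ≡⟨ cong (_* oddDF (π i)) (weightProd-zeroAt B (zeroAt i π) (≤-trans 2≤i (<⇒≤ i<j)) j≤B) ⟩
  weightProd B (zeroAt j (zeroAt i π)) * oddDF (zeroAt i π j) * oddDF (π i)
    ≡⟨ cong (λ v → weightProd B (zeroAt j (zeroAt i π)) * oddDF v * oddDF (π i))
            (zeroAt-≢ i π (≢-sym (<⇒≢ i<j))) ⟩
  weightProd B (zeroAt j (zeroAt i π)) * oddDF (π j) * oddDF (π i)
    ≡⟨ *-CS.xy∙z≈x∙zy (weightProd B (zeroAt j (zeroAt i π))) (oddDF (π j)) (oddDF (π i)) ⟩
  weightProd B (zeroAt j (zeroAt i π)) * (oddDF (π i) * oddDF (π j))  ∎
  where open ≡-Reasoning

weightProd-0̇ : ∀ B → weightProd B 0̇ ≡ 1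
weightProd-0̇ zero    = refl
weightProd-0̇ (suc B) = cong₂ _*_ (weightProd-0̇ B) (weight-zero (suc B))

weightProd-only-colour1 : ∀ B ρ → 1 ≤ B → (∀ c → 2 ≤ c → ρ c ≡ 0) → weightProd B ρ ≡ d (ρ 1)
weightProd-only-colour1 (suc zero)    ρ _ ρ≡0 = *-identityˡ _
weightProd-only-colour1 (suc (suc B)) ρ _ ρ≡0 = begin
  weightProd (suc B) ρ * weight (suc (suc B)) (ρ (suc (suc B)))
    ≡⟨ cong₂ _*_ (weightProd-only-colour1 (suc B) ρ (s≤s z≤n) ρ≡0)
                 (cong oddDF (ρ≡0 (suc (suc B)) (s≤s (s≤s z≤n)))) ⟩
  d (ρ 1) * 1
    ≡⟨ *-identityʳ _ ⟩
  d (ρ 1)  ∎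
  where open ≡-Reasoning

colour1≡1⇒weightProd≡0 : ∀ B ρ → 1 ≤ B → ρ 1 ≡ 1 → weightProd B ρ ≡ 0
colour1≡1⇒weightProd≡0 (suc zero)    ρ _ ρ1≡1 rewrite ρ1≡1 = refl
colour1≡1⇒weightProd≡0 (suc (suc B)) ρ _ ρ1≡1 rewrite colour1≡1⇒weightProd≡0 (suc B) ρ (s≤s z≤n) ρ1≡1 = refl

weightProd≡0⇒colour1≡1 : ∀ B ρ → weightProd B ρ ≡ 0 → ρ 1 ≡ 1
weightProd≡0⇒colour1≡1 (suc B) ρ w≡0 with m*n≡0⇒m≡0∨n≡0 (weightProd B ρ) w≡0
... | inj₁ w′≡0 = weightProd≡0⇒colour1≡1 B ρ w′≡0
... | inj₂ w≡0′ with weight≡0⇒ (suc B) (ρ (suc B)) w≡0′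
...   | refl , ρ1≡1 = ρ1≡1

-- Colourings of columns

-- The sum over all ways to give each column of height l > 0 a colour in 1..l, weighted by
-- weightProd of the resulting colour counts (added to π).
colourSum : ℕ → List ℕ → (ℕ → ℕ) → ℕ
colourSum B []          π = weightProd B π
colourSum B (zero  ∷ X) π = colourSum B X π
colourSum B (suc l ∷ X) π = sumFrom1 (suc l) λ c → colourSum B X (incAt c π)

colourSum-cong : ∀ B X {π σ : ℕ → ℕ} → (∀ x → π x ≡ σ x) → colourSum B X π ≡ colourSum B X σ
colourSum-cong B []          e = weightProd-cong B λ x _ _ → e x
colourSum-cong B (zero  ∷ X) e = colourSum-cong B X e
colourSum-cong B (suc l ∷ X) e = sumFrom1-cong (suc l) λ c _ _ → colourSum-cong B X (incAt-cong c e)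

colourSum-∷-cong : ∀ B x {X Y} → (∀ π → colourSum B X π ≡ colourSum B Y π) →
  ∀ π → colourSum B (x ∷ X) π ≡ colourSum B (x ∷ Y) π
colourSum-∷-cong B zero    e π = e π
colourSum-∷-cong B (suc l) e π = sumFrom1-cong (suc l) λ c _ _ → e (incAt c π)

colourSum-swap : ∀ B x y X π → colourSum B (x ∷ y ∷ X) π ≡ colourSum B (y ∷ x ∷ X) π
colourSum-swap B zero    zero    X π = refl
colourSum-swap B zero    (suc l) X π = refl
colourSum-swap B (suc l) zero    X π = refl
colourSum-swap B (suc l) (suc m) X π = trans
  (sumFrom1-comm (suc l) (suc m) λ c c′ → colourSum B X (incAt c′ (incAt c π)))
  (sumFrom1-cong (suc m) λ c′ _ _ → sumFrom1-cong (suc l) λ c _ _ → colourSum-cong B X (incAt-comm c′ c π))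

colourSum-↭ : ∀ B {X Y} → X ↭ Y → ∀ π → colourSum B X π ≡ colourSum B Y π
colourSum-↭ B ↭-refl           π = refl
colourSum-↭ B (↭-prep x p)     π = colourSum-∷-cong B x (colourSum-↭ B p) π
colourSum-↭ B (↭-swap x y p) π = trans (colourSum-swap B x y _ π)
  (colourSum-∷-cong B y (colourSum-∷-cong B x (colourSum-↭ B p)) π)
colourSum-↭ B (↭-trans p q)    π = trans (colourSum-↭ B p π) (colourSum-↭ B q π)

nonzeros : List ℕ → ℕ
nonzeros []          = 0
nonzeros (zero  ∷ X) = nonzeros X
nonzeros (suc _ ∷ X) = suc (nonzeros X)

colourSum-heights≤1 : ∀ B X → All (_≤ 1) X → ∀ π → colourSum B X π ≡ weightProd B (addAt 1 (nonzeros X) π)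
colourSum-heights≤1 B []               []      π = refl
colourSum-heights≤1 B (zero ∷ X)       (_ ∷ p) π = colourSum-heights≤1 B X p π
colourSum-heights≤1 B (suc zero ∷ X)   (_ ∷ p) π = colourSum-heights≤1 B X p (incAt 1 π)
colourSum-heights≤1 B (suc (suc _) ∷ X) (s≤s () ∷ _) π

colourSum-single-cell : ∀ B {X} → All (_≤ 1) X → nonzeros X ≡ 1 → ∀ π →
  colourSum B X π ≡ weightProd B (incAt 1 π)
colourSum-single-cell B {X} X≤1 nz≡1 π =
  trans (colourSum-heights≤1 B X X≤1 π) (cong (λ n → weightProd B (addAt 1 n π)) nz≡1)

-- A colour R above every column contributes only its own factor oddDF k.
colourSum-addAt : ∀ B {R} Z k π → 2 ≤ R → R ≤ B → All (_< R) Z → π R ≡ 0 →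
  colourSum B Z (addAt R k π) ≡ oddDF k * colourSum B Z π
colourSum-addAt B {R} [] k π 2≤R R≤B [] πR≡0 = begin
  weightProd B (addAt R k π)
    ≡⟨ weightProd-zeroAt B (addAt R k π) 2≤R R≤B ⟩
  weightProd B (zeroAt R (addAt R k π)) * oddDF (addAt R k π R)
    ≡⟨ cong₂ _*_ (weightProd-cong B λ x _ _ → zeroAt-congAt R x (addAt-≢ R k π))
                 (cong oddDF (trans (addAt-≡ R k π) (trans (cong (k +_) πR≡0) (+-identityʳ k)))) ⟩
  weightProd B (zeroAt R π) * oddDF k
    ≡⟨ *-comm _ (oddDF k) ⟩
  oddDF k * weightProd B (zeroAt R π)
    ≡⟨ cong (λ w → oddDF k * w) (*-identityʳ _) ⟨
  oddDF k * (weightProd B (zeroAt R π) * oddDF 0)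
    ≡⟨ cong (λ v → oddDF k * (weightProd B (zeroAt R π) * oddDF v)) πR≡0 ⟨
  oddDF k * (weightProd B (zeroAt R π) * oddDF (π R))
    ≡⟨ cong (oddDF k *_) (weightProd-zeroAt B π 2≤R R≤B) ⟨
  oddDF k * weightProd B π  ∎
  where open ≡-Reasoning
colourSum-addAt B (zero ∷ Z) k π 2≤R R≤B (_ ∷ Z<R) πR≡0 = colourSum-addAt B Z k π 2≤R R≤B Z<R πR≡0
colourSum-addAt B {R} (suc l ∷ Z) k π 2≤R R≤B (l<R ∷ Z<R) πR≡0 = trans
  (sumFrom1-cong (suc l) λ c _ c≤1+l → trans
    (colourSum-cong B Z (incAt-addAt R k c π))
    (colourSum-addAt B Z k (incAt c π) 2≤R R≤B Z<R
      (trans (incAt-≢ c π λ R≡c → <⇒≢ (≤-trans (s≤s c≤1+l) l<R) (sym R≡c)) πR≡0)))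
  (sumFrom1-*ˡ (suc l) (oddDF k) λ c → colourSum B Z (incAt c π))

weightProd-incAt-unused : ∀ B {c} π → 2 ≤ c → c ≤ B → π c ≡ 0 → weightProd B (incAt c π) ≡ weightProd B π
weightProd-incAt-unused B π 2≤c c≤B πc≡0 =
  trans (colourSum-addAt B [] 1 π 2≤c c≤B [] πc≡0) (*-identityˡ _)

-- Each of the m columns of height R either takes colour R or is lowered to height R - 1.
colourSum-replicate-top : ∀ B r m Y π →
  colourSum B (replicate m (suc (suc r)) ++ Y) π
    ≡ sumFrom0 m λ k → (m C k) * colourSum B (replicate (m ∸ k) (suc r) ++ Y) (addAt (suc (suc r)) k π)
colourSum-replicate-top B r zero    Y π = sym (trans (+-identityʳ _) (*-identityˡ _))
colourSum-replicate-top B r (suc m) Y π = begin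
  colourSum B (suc r ∷ replicate m R ++ Y) π + colourSum B (replicate m R ++ Y) (incAt R π)
    ≡⟨ cong₂ _+_ lowered (colourSum-replicate-top B r m Y (incAt R π)) ⟩
  sumFrom0 m (λ k → (m C k) * T k) + sumFrom0 m (λ k → (m C k) * T (suc k))
    ≡⟨ sumFrom0-binomial-suc m T ⟨
  sumFrom0 (suc m) (λ k → (suc m C k) * T k)  ∎
  where
  open ≡-Reasoning
  R = suc (suc r)
  T : ℕ → ℕ
  T k = colourSum B (replicate (suc m ∸ k) (suc r) ++ Y) (addAt R k π)
  lowered : colourSum B (suc r ∷ replicate m R ++ Y) π ≡ sumFrom0 m (λ k → (m C k) * T k)
  lowered = begin
    colourSum B (suc r ∷ replicate m R ++ Y) π
      ≡⟨ colourSum-↭ B (↭-shift (suc r) (replicate m R) Y) π ⟨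
    colourSum B (replicate m R ++ suc r ∷ Y) π
      ≡⟨ colourSum-replicate-top B r m (suc r ∷ Y) π ⟩
    sumFrom0 m (λ k → (m C k) * colourSum B (replicate (m ∸ k) (suc r) ++ suc r ∷ Y) (addAt R k π))
      ≡⟨ sumFrom0-cong m (λ k k≤m → cong ((m C k) *_) (trans
           (colourSum-↭ B (↭-shift (suc r) (replicate (m ∸ k) (suc r)) Y) (addAt R k π))
           (cong (λ n → colourSum B (replicate n (suc r) ++ Y) (addAt R k π)) (sym (+-∸-assoc 1 k≤m))))) ⟩
    sumFrom0 m (λ k → (m C k) * T k)  ∎

-- Majorization

record Majorizes (i j : ℕ) (π π′ : ℕ → ℕ) : Set where
  constructor majorizes
  field
    agree : ∀ x → x ≢ i → x ≢ j → π′ x ≡ π x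
    total : π′ i + π′ j ≡ π i + π j
    i-≤   : π′ i ≤ π i
    j-≤   : π′ j ≤ π i

weightProd-majorizes : ∀ B {i j π π′} → 2 ≤ i → i < j → j ≤ B → Majorizes i j π π′ →
  weightProd B π′ ≤ weightProd B π
weightProd-majorizes B {i} {j} {π} {π′} 2≤i i<j j≤B (majorizes agree total i-≤ j-≤) = begin
  weightProd B π′
    ≡⟨ weightProd-zeroAt₂ B π′ 2≤i i<j j≤B ⟩
  weightProd B (zeroAt j (zeroAt i π′)) * (oddDF (π′ i) * oddDF (π′ j))
    ≤⟨ *-mono-≤ (≤-reflexive rest) (oddDF-*-majorization-≤ (sym total) i-≤ j-≤) ⟩
  weightProd B (zeroAt j (zeroAt i π)) * (oddDF (π i) * oddDF (π j))
    ≡⟨ weightProd-zeroAt₂ B π 2≤i i<j j≤B ⟨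
  weightProd B π  ∎
  where
  open ≤-Reasoning
  rest : weightProd B (zeroAt j (zeroAt i π′)) ≡ weightProd B (zeroAt j (zeroAt i π))
  rest = weightProd-cong B λ x _ _ →
    zeroAt-congAt j x λ x≢j → zeroAt-congAt i x λ x≢i → agree x x≢i x≢j

majorizes-via : ∀ {i j a b a′ b′} {π π′ : ℕ → ℕ} → (∀ x → x ≢ i → x ≢ j → π′ x ≡ π x) →
  π′ i ≡ a′ → π′ j ≡ b′ → π i ≡ a → π j ≡ b → a′ + b′ ≡ a + b → a′ ≤ a → b′ ≤ a →
  Majorizes i j π π′
majorizes-via agree refl refl refl refl = majorizes agree

module _ {i j : ℕ} (i<j : i < j) where

  private
    j≢i : j ≢ i
    j≢i = ≢-sym (<⇒≢ i<j)

    incAt-pair-agree : ∀ {c c′ π π′} → (c ≡ i ⊎ c ≡ j) → (c′ ≡ i ⊎ c′ ≡ j) → Majorizes i j π π′ →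
      ∀ x → x ≢ i → x ≢ j → incAt c π′ x ≡ incAt c′ π x
    incAt-pair-agree {c} {c′} {π} {π′} c∈ c′∈ m x x≢i x≢j =
      trans (incAt-≢ c π′ (∉ c∈)) (trans (Majorizes.agree m x x≢i x≢j) (sym (incAt-≢ c′ π (∉ c′∈))))
      where
      ∉ : ∀ {y} → y ≡ i ⊎ y ≡ j → x ≢ y
      ∉ (inj₁ refl) = x≢i
      ∉ (inj₂ refl) = x≢j

  Majorizes-incAt : ∀ c {π π′} → c ≢ i → c ≢ j → Majorizes i j π π′ →
    Majorizes i j (incAt c π) (incAt c π′)
  Majorizes-incAt c {π} {π′} c≢i c≢j (majorizes agree total i-≤ j-≤) = majorizes-via
    (λ x x≢i x≢j → cong (δ x c +_) (agree x x≢i x≢j))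
    (incAt-≢ c π′ (≢-sym c≢i)) (incAt-≢ c π′ (≢-sym c≢j))
    (incAt-≢ c π (≢-sym c≢i)) (incAt-≢ c π (≢-sym c≢j))
    total i-≤ j-≤

  Majorizes-incAt-i-i : ∀ {π π′} → Majorizes i j π π′ → Majorizes i j (incAt i π) (incAt i π′)
  Majorizes-incAt-i-i {π} {π′} m@(majorizes _ total i-≤ j-≤) = majorizes-via
    (incAt-pair-agree (inj₁ refl) (inj₁ refl) m)
    (incAt-≡ i π′ refl) (incAt-≢ i π′ j≢i) (incAt-≡ i π refl) (incAt-≢ i π j≢i)
    (cong suc total) (s≤s i-≤) (m≤n⇒m≤1+n j-≤)

  Majorizes-incAt-j-i : ∀ {π π′} → π′ i < π i → Majorizes i j π π′ → Majorizes i j (incAt j π) (incAt i π′)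
  Majorizes-incAt-j-i {π} {π′} π′i<πi m@(majorizes _ total _ j-≤) = majorizes-via
    (incAt-pair-agree (inj₁ refl) (inj₂ refl) m)
    (incAt-≡ i π′ refl) (incAt-≢ i π′ j≢i) (incAt-≢ j π (<⇒≢ i<j)) (incAt-≡ j π refl)
    (trans (cong suc total) (sym (+-suc (π i) (π j)))) π′i<πi j-≤

  Majorizes-incAt-i-j : ∀ {π π′} → Majorizes i j π π′ → Majorizes i j (incAt i π) (incAt j π′)
  Majorizes-incAt-i-j {π} {π′} m@(majorizes _ total i-≤ j-≤) = majorizes-via
    (incAt-pair-agree (inj₂ refl) (inj₁ refl) m)
    (incAt-≢ j π′ (<⇒≢ i<j)) (incAt-≡ j π′ refl) (incAt-≡ i π refl) (incAt-≢ i π j≢i)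
    (trans (+-suc (π′ i) (π′ j)) (cong suc total)) (m≤n⇒m≤1+n i-≤) (s≤s j-≤)

Majorizes-shift : ∀ {i j c π} → i < j → c ≢ i → c ≢ j → π j ≤ π i →
  Majorizes i j (incAt i (incAt c π)) (incAt c (incAt j π))
Majorizes-shift {i} {j} {c} {π} i<j c≢i c≢j πj≤πi = majorizes-via
  (λ x x≢i x≢j → trans (cong (δ x c +_) (incAt-≢ j π x≢j))
                       (sym (incAt-≢ i (incAt c π) x≢i)))
  (trans (incAt-≢ c (incAt j π) (≢-sym c≢i)) (incAt-≢ j π (<⇒≢ i<j)))
  (trans (incAt-≢ c (incAt j π) (≢-sym c≢j)) (incAt-≡ j π refl))
  (trans (incAt-≡ i (incAt c π) refl) (cong suc (incAt-≢ c π (≢-sym c≢i))))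
  (trans (incAt-≢ i (incAt c π) (≢-sym (<⇒≢ i<j))) (incAt-≢ c π (≢-sym c≢j)))
  (+-suc (π i) (π j)) (n≤1+n (π i)) (s≤s πj≤πi)

colourSum-majorizes : ∀ B {i j} → 2 ≤ i → i < j → j ≤ B → ∀ X {π π′} → Majorizes i j π π′ →
  colourSum B X π′ ≤ colourSum B X π
colourSum-majorizes B 2≤i i<j j≤B []          m = weightProd-majorizes B 2≤i i<j j≤B m
colourSum-majorizes B 2≤i i<j j≤B (zero  ∷ X) m = colourSum-majorizes B 2≤i i<j j≤B X m
colourSum-majorizes B {i} {j} 2≤i i<j j≤B (suc l ∷ X) {π} {π′} m@(majorizes agree total i-≤ j-≤)
  with π′ i ≟ π i
... | yes π′i≡πi = ≤-reflexive (colourSum-cong B (suc l ∷ X) π′≗π)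
  where
  π′j≡πj : π′ j ≡ π j
  π′j≡πj = +-cancelˡ-≡ (π i) (π′ j) (π j) (trans (cong (_+ π′ j) (sym π′i≡πi)) total)
  π′≗π : ∀ x → π′ x ≡ π x
  π′≗π x with x ≟ i | x ≟ j
  ... | yes refl | _        = π′i≡πi
  ... | no _     | yes refl = π′j≡πj
  ... | no x≢i   | no x≢j   = agree x x≢i x≢j
... | no π′i≢πi = sumFrom1-mono-≤-except₂ (suc l) (≤-trans (s≤s z≤n) 2≤i) i<j
  (λ c c≢i c≢j → recurse (Majorizes-incAt i<j c c≢i c≢j m))
  (recurse (Majorizes-incAt-i-i i<j m))
  (λ _ → ≤-trans
    (+-mono-≤ (recurse (Majorizes-incAt-j-i i<j (≤∧≢⇒< i-≤ π′i≢πi) m)) (recurse (Majorizes-incAt-i-j i<j m)))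
    (≤-reflexive (+-comm (colourSum B X (incAt j π)) _)))
  where
  recurse : ∀ {ρ ρ′} → Majorizes i j ρ ρ′ → colourSum B X ρ′ ≤ colourSum B X ρ
  recurse = colourSum-majorizes B 2≤i i<j j≤B X

-- The extra term counts the colourings of the right-hand side giving both changed columns colour i.
colourSum-shift-≥ : ∀ B {a b} Z π → a < b → suc (suc b) ≤ B → π (suc (suc b)) ≤ π (suc (suc a)) →
  colourSum B (suc (suc b) ∷ suc a ∷ Z) π + colourSum B Z (incAt (suc (suc a)) (incAt (suc (suc a)) π))
    ≤ colourSum B (suc b ∷ suc (suc a) ∷ Z) π
colourSum-shift-≥ B {a} {b} Z π a<b j≤B πj≤πi = begin
  sumFrom1 (suc b) G + G j + h i         ≡⟨ +-assoc (sumFrom1 (suc b) G) (G j) (h i) ⟩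
  sumFrom1 (suc b) G + (G j + h i)       ≤⟨ +-monoʳ-≤ (sumFrom1 (suc b) G) (≤-trans
                                              (+-monoˡ-≤ (h i) Gj≤) (sumFrom1-prefix-≤ (suc b) (suc a) h (s≤s a<b))) ⟩
  sumFrom1 (suc b) G + sumFrom1 (suc b) h ≡⟨ sumFrom1-+ (suc b) G h ⟨
  sumFrom1 (suc b) (λ c → G c + h c)    ∎
  where
  open ≤-Reasoning
  i = suc (suc a)
  j = suc (suc b)
  i<j : i < j
  i<j = s≤s (s≤s a<b)
  G h : ℕ → ℕ
  G c = colourSum B (suc a ∷ Z) (incAt c π)
  h c = colourSum B Z (incAt i (incAt c π))
  Gj≤ : G j ≤ sumFrom1 (suc a) h
  Gj≤ = sumFrom1-mono-≤ (suc a) λ c _ c≤1+a → colourSum-majorizes B (s≤s (s≤s z≤n)) i<j j≤B Z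
    (Majorizes-shift i<j (<⇒≢ (s≤s c≤1+a)) (<⇒≢ (≤-trans (s≤s c≤1+a) (<⇒≤ i<j))) πj≤πi)

-- With Z a single cell, only colourings using colour 1 exactly twice survive, and they match up.
colourSum-shift-≡ : ∀ B {a b} Z → a < b → suc (suc b) ≤ B → All (_≤ 1) Z → nonzeros Z ≡ 1 →
  colourSum B (suc (suc b) ∷ suc a ∷ Z) 0̇ ≡ colourSum B (suc b ∷ suc (suc a) ∷ Z) 0̇
colourSum-shift-≡ B {a} {b} Z a<b j≤B Z≤1 nz≡1 = begin
  sumFrom1 (suc b) G + G j                 ≡⟨ cong (sumFrom1 (suc b) G +_) Gj≡ ⟩
  sumFrom1 (suc b) G + sumFrom1 (suc b) h  ≡⟨ sumFrom1-+ (suc b) G h ⟨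
  sumFrom1 (suc b) (λ c → G c + h c)      ∎
  where
  open ≡-Reasoning
  i = suc (suc a)
  j = suc (suc b)
  G h : ℕ → ℕ
  G c = colourSum B (suc a ∷ Z) (incAt c 0̇)
  h c = colourSum B Z (incAt i (incAt c 0̇))
  1≤B : 1 ≤ B
  1≤B = ≤-trans (s≤s z≤n) j≤B
  colourSum-Z : ∀ ρ → colourSum B Z ρ ≡ weightProd B (incAt 1 ρ)
  colourSum-Z = colourSum-single-cell B Z≤1 nz≡1
  -- the only cell of colour 1 is then the one in Z, and d 1 = 0
  only-colour-1 : ∀ {c} ρ → 2 ≤ c → ρ 1 ≡ 0 → colourSum B Z (incAt c ρ) ≡ 0
  only-colour-1 {c} ρ 2≤c ρ1≡0 = trans (colourSum-Z (incAt c ρ)) (colour1≡1⇒weightProd≡0 B _ 1≤B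
    (trans (incAt-≡ 1 (incAt c ρ) refl) (cong suc (trans (incAt-≢ c ρ (<⇒≢ 2≤c)) ρ1≡0))))
  σ = incAt 1 (incAt 1 0̇)
  σ-free : ∀ {c} → 2 ≤ c → σ c ≡ 0
  σ-free 2≤c = trans (incAt-≢ 1 (incAt 1 0̇) (≢-sym (<⇒≢ 2≤c))) (incAt-≢ 1 0̇ (≢-sym (<⇒≢ 2≤c)))
  Gj≡ : G j ≡ sumFrom1 (suc b) h
  Gj≡ = begin
    sumFrom1 (suc a) (λ c → colourSum B Z (incAt c (incAt j 0̇)))
      ≡⟨ sumFrom1-first-only a (λ c → colourSum B Z (incAt c (incAt j 0̇)))
           (λ c 2≤c → only-colour-1 (incAt j 0̇) 2≤c refl) ⟩
    colourSum B Z (incAt 1 (incAt j 0̇))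
      ≡⟨ colourSum-Z (incAt 1 (incAt j 0̇)) ⟩
    weightProd B (incAt 1 (incAt 1 (incAt j 0̇)))
      ≡⟨ weightProd-cong B (λ x _ _ → trans (incAt-cong 1 (incAt-comm 1 j 0̇) x) (incAt-comm 1 j (incAt 1 0̇) x)) ⟩
    weightProd B (incAt j σ)
      ≡⟨ weightProd-incAt-unused B σ (s≤s (s≤s z≤n)) j≤B (σ-free {j} (s≤s (s≤s z≤n))) ⟩
    weightProd B σ
      ≡⟨ weightProd-incAt-unused B σ (s≤s (s≤s z≤n)) (≤-trans (<⇒≤ (s≤s (s≤s a<b))) j≤B)
           (σ-free {i} (s≤s (s≤s z≤n))) ⟨
    weightProd B (incAt i σ)
      ≡⟨ weightProd-cong B (λ x _ _ → incAt-comm i 1 (incAt 1 0̇) x) ⟩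
    weightProd B (incAt 1 (incAt i (incAt 1 0̇)))
      ≡⟨ colourSum-Z (incAt i (incAt 1 0̇)) ⟨
    h 1
      ≡⟨ sumFrom1-first-only b h (λ c 2≤c → only-colour-1 (incAt c 0̇) (s≤s (s≤s z≤n)) (incAt-≢ c 0̇ (<⇒≢ 2≤c))) ⟨
    sumFrom1 (suc b) h  ∎

colourSum-≥-colour1 : ∀ B Z ρ → Σ (ℕ → ℕ) λ ρ″ → ρ″ 1 ≡ nonzeros Z + ρ 1 × weightProd B ρ″ ≤ colourSum B Z ρ
colourSum-≥-colour1 B []          ρ = ρ , refl , ≤-refl
colourSum-≥-colour1 B (zero  ∷ Z) ρ = colourSum-≥-colour1 B Z ρ
colourSum-≥-colour1 B (suc l ∷ Z) ρ with colourSum-≥-colour1 B Z (incAt 1 ρ)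
... | ρ″ , ρ″1≡ , ≤F = ρ″
  , trans ρ″1≡ (trans (cong (nonzeros Z +_) (incAt-≡ 1 ρ refl)) (+-suc (nonzeros Z) (ρ 1)))
  , ≤-trans ≤F (sumFrom1-≥-first l λ c → colourSum B Z (incAt c ρ))

colourSum-≥-colour2 : ∀ B {Z} → Any (2 ≤_) Z → ∀ ρ →
  Σ (ℕ → ℕ) λ ρ″ → suc (ρ″ 1) ≡ nonzeros Z + ρ 1 × weightProd B ρ″ ≤ colourSum B Z ρ
colourSum-≥-colour2 B (here {x = suc (suc l)} {Z} _) ρ with colourSum-≥-colour1 B Z (incAt 2 ρ)
... | ρ″ , ρ″1≡ , ≤F = ρ″
  , cong suc (trans ρ″1≡ (cong (nonzeros Z +_) (incAt-≢ 2 ρ λ ())))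
  , ≤-trans ≤F (sumFrom1-≥-second l λ c → colourSum B Z (incAt c ρ))
colourSum-≥-colour2 B (here {x = suc zero} (s≤s ())) ρ
colourSum-≥-colour2 B (there {zero} p) ρ = colourSum-≥-colour2 B p ρ
colourSum-≥-colour2 B (there {suc l} {Z} p) ρ with colourSum-≥-colour2 B p (incAt 1 ρ)
... | ρ″ , ρ″1≡ , ≤F = ρ″
  , trans ρ″1≡ (trans (cong (nonzeros Z +_) (incAt-≡ 1 ρ refl)) (+-suc (nonzeros Z) (ρ 1)))
  , ≤-trans ≤F (sumFrom1-≥-first l λ c → colourSum B Z (incAt c ρ))

-- A weight vanishes only with exactly one cell of colour 1; apply this to the colouring by 1 alone
-- and to one that gives a column of height ≥ 2 the colour 2.
colourSum≡0⇒ : ∀ B Z ρ → ρ 1 ≡ 0 → colourSum B Z ρ ≡ 0 → nonzeros Z ≡ 1 × All (_≤ 1) Z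
colourSum≡0⇒ B Z ρ ρ1≡0 F≡0 = nonzeros≡1 , ¬2≤⇒≤1 (¬Any⇒All¬ Z no-column≥2)
  where
  ρ1+ : ∀ n → n + ρ 1 ≡ n
  ρ1+ n = trans (cong (n +_) ρ1≡0) (+-identityʳ n)
  forced : ∀ {ρ″} → weightProd B ρ″ ≤ colourSum B Z ρ → ρ″ 1 ≡ 1
  forced ≤F = weightProd≡0⇒colour1≡1 B _ (n≤0⇒n≡0 (subst (_ ≤_) F≡0 ≤F))
  nonzeros≡1 : nonzeros Z ≡ 1
  nonzeros≡1 with colourSum-≥-colour1 B Z ρ
  ... | ρ″ , ρ″1≡ , ≤F = trans (sym (ρ1+ (nonzeros Z))) (trans (sym ρ″1≡) (forced ≤F))
  no-column≥2 : ¬ Any (2 ≤_) Z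
  no-column≥2 any with colourSum-≥-colour2 B any ρ
  ... | ρ″ , ρ″1≡ , ≤F = contradiction
    (trans (sym (cong suc (forced ≤F))) (trans ρ″1≡ (trans (ρ1+ (nonzeros Z)) nonzeros≡1))) λ ()
  ¬2≤⇒≤1 : ∀ {X} → All (λ x → ¬ 2 ≤ x) X → All (_≤ 1) X
  ¬2≤⇒≤1 = All.map λ ¬2≤x → s≤s⁻¹ (≰⇒> ¬2≤x)

-- Conjugate partitions

atLeast : ℕ → ℕ → ℕ
atLeast t x with t ≤? x
... | yes _ = 1
... | no  _ = 0

atLeast-≤ : ∀ {t x} → t ≤ x → atLeast t x ≡ 1
atLeast-≤ {t} {x} t≤x with t ≤? x
... | yes _   = refl
... | no t≰x = contradiction t≤x t≰x

atLeast-> : ∀ {t x} → x < t → atLeast t x ≡ 0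
atLeast-> {t} {x} x<t with t ≤? x
... | yes t≤x = contradiction t≤x (<⇒≱ x<t)
... | no _    = refl

atLeast-≤1 : ∀ t x → atLeast t x ≤ 1
atLeast-≤1 t x with t ≤? x
... | yes _ = ≤-refl
... | no  _ = z≤n

atLeast-suc : ∀ {t x} → t ≢ suc x → atLeast t (suc x) ≡ atLeast t x
atLeast-suc {t} {x} t≢1+x with t ≤? x
... | yes t≤x = atLeast-≤ (m≤n⇒m≤1+n t≤x)
... | no t≰x  = atLeast-> (≤∧≢⇒< (≰⇒> t≰x) (≢-sym t≢1+x))

atLeast-pred : ∀ {t x} → 1 ≤ x → t ≢ x → atLeast t (x ∸ 1) ≡ atLeast t x
atLeast-pred {x = suc x} _ t≢1+x = sym (atLeast-suc t≢1+x)

atLeast-∸ : ∀ {t} k x → 1 ≤ t → atLeast t (x ∸ k) ≡ atLeast (t + k) x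
atLeast-∸ {t} k x 1≤t with t + k ≤? x
... | yes t+k≤x = atLeast-≤ (subst (_≤ x ∸ k) (m+n∸n≡m t k) (∸-monoˡ-≤ k t+k≤x))
... | no t+k≰x  = atLeast-> (m<n+o⇒m∸n<o x k {{>-nonZero 1≤t}} (subst (x <_) (+-comm t k) (≰⇒> t+k≰x)))

-- conj λ t = λ′_t, the t-th part of the conjugate partition
conj : List ℕ → ℕ → ℕ
conj []       t = 0
conj (x ∷ xs) t = atLeast t x + conj xs t

conj-≤-length : ∀ xs t → conj xs t ≤ length xs
conj-≤-length []       t = z≤n
conj-≤-length (x ∷ xs) t = +-mono-≤ (atLeast-≤1 t x) (conj-≤-length xs t)

conj-all-≥ : ∀ {xs t} → All (t ≤_) xs → conj xs t ≡ length xs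
conj-all-≥ []           = refl
conj-all-≥ (t≤x ∷ t≤xs) = cong₂ _+_ (atLeast-≤ t≤x) (conj-all-≥ t≤xs)

conj-all-< : ∀ {xs t} → All (_< t) xs → conj xs t ≡ 0
conj-all-< []           = refl
conj-all-< (x<t ∷ xs<t) = cong₂ _+_ (atLeast-> x<t) (conj-all-< xs<t)

conj-dropLast : ∀ x xs t → conj (x ∷ xs) t ≡ conj (dropLast (x ∷ xs)) t + atLeast t (lastPart (x ∷ xs))
conj-dropLast x []       t = +-comm (atLeast t x) 0
conj-dropLast x (y ∷ ys) t =
  trans (cong (atLeast t x +_) (conj-dropLast y ys t)) (sym (+-assoc (atLeast t x) _ _))

conj-map-∸ : ∀ xs k {t} → 1 ≤ t → conj (map (_∸ k) xs) t ≡ conj xs (t + k)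
conj-map-∸ []       k 1≤t = refl
conj-map-∸ (x ∷ xs) k 1≤t = cong₂ _+_ (atLeast-∸ k x 1≤t) (conj-map-∸ xs k 1≤t)

conj-dropZeros : ∀ xs {t} → 1 ≤ t → conj (dropZeros xs) t ≡ conj xs t
conj-dropZeros []           1≤t = refl
conj-dropZeros (zero  ∷ xs) {t} 1≤t = trans (conj-dropZeros xs 1≤t) (sym (cong (_+ conj xs t) (atLeast-> 1≤t)))
conj-dropZeros (suc x ∷ xs) 1≤t = cong (atLeast _ (suc x) +_) (conj-dropZeros xs 1≤t)

conj-minusHat : ∀ xs k {t} → 1 ≤ t → conj (minusHat xs k) t ≡ conj xs (t + k)
conj-minusHat xs k 1≤t = trans (conj-dropZeros (map (_∸ k) xs) 1≤t) (conj-map-∸ xs k 1≤t)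

NonIncreasing : List ℕ → Set
NonIncreasing = Linked λ a b → b ≤ a

NonIncreasing-dropLast : ∀ {xs} → NonIncreasing xs → NonIncreasing (dropLast xs)
NonIncreasing-dropLast []                 = []
NonIncreasing-dropLast [-]                = []
NonIncreasing-dropLast (_ ∷ [-])          = [-]
NonIncreasing-dropLast (y≤x ∷ zs@(_ ∷ _)) = y≤x ∷ NonIncreasing-dropLast zs

NonIncreasing-minusHat : ∀ {xs} k → NonIncreasing xs → NonIncreasing (minusHat xs k)
NonIncreasing-minusHat k =
  Linked.filter⁺ (λ x → ¬? (x ≟ 0)) (λ z≤y y≤x → ≤-trans y≤x z≤y) ∘ Linked.map⁺ ∘ Linked.map (∸-monoˡ-≤ k)

NonIncreasing-head : ∀ {x xs} → NonIncreasing (x ∷ xs) → All (_≤ x) xs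
NonIncreasing-head [-]           = []
NonIncreasing-head (y≤x ∷ rest) = y≤x ∷ All.map (λ z≤y → ≤-trans z≤y y≤x) (NonIncreasing-head rest)

lastPart-≤ : ∀ {xs} → NonIncreasing xs → All (lastPart xs ≤_) xs
lastPart-≤ []           = []
lastPart-≤ [-]          = ≤-refl ∷ []
lastPart-≤ (y≤x ∷ rest) with lastPart-≤ rest
... | l≤y ∷ l≤ys = ≤-trans l≤y y≤x ∷ l≤y ∷ l≤ys

All-lastPart : ∀ {P : ℕ → Set} {x xs} → All P (x ∷ xs) → P (lastPart (x ∷ xs))
All-lastPart (px ∷ [])       = px
All-lastPart (_ ∷ py ∷ pys) = All-lastPart (py ∷ pys)

All-dropLast : ∀ {P : ℕ → Set} {xs} → All P xs → All P (dropLast xs)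
All-dropLast []                 = []
All-dropLast (_ ∷ [])           = []
All-dropLast (px ∷ py ∷ pys) = px ∷ All-dropLast (py ∷ pys)

length-dropLast : ∀ x xs → suc (length (dropLast (x ∷ xs))) ≡ length (x ∷ xs)
length-dropLast x []       = refl
length-dropLast x (y ∷ ys) = cong suc (length-dropLast y ys)

length-minusHat : ∀ xs k → length (minusHat xs k) ≤ length xs
length-minusHat xs k = ≤-trans (length-filter (λ x → ¬? (x ≟ 0)) (map (_∸ k) xs)) (≤-reflexive (length-map (_∸ k) xs))

All-minusHat : ∀ {N xs} k → All (_≤ N) xs → All (_≤ N ∸ k) (minusHat xs k)
All-minusHat k = AllP.filter⁺ (λ x → ¬? (x ≟ 0)) ∘ AllP.map⁺ ∘ All.map (∸-monoˡ-≤ k)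

segment : (ℕ → ℕ) → ℕ → ℕ → List ℕ
segment g a zero    = []
segment g a (suc n) = g (suc a) ∷ segment g (suc a) n

segment-cong : ∀ a n {g h : ℕ → ℕ} → (∀ t → a < t → t ≤ a + n → g t ≡ h t) → segment g a n ≡ segment h a n
segment-cong a zero    e = refl
segment-cong a (suc n) e = cong₂ _∷_
  (e (suc a) ≤-refl (≤-trans (s≤s (m≤m+n a n)) (≤-reflexive (sym (+-suc a n)))))
  (segment-cong (suc a) n λ t a+1<t t≤ → e t (<⇒≤ a+1<t) (subst (t ≤_) (sym (+-suc a n)) t≤))

segment-const : ∀ a n v → segment (λ _ → v) a n ≡ replicate n v
segment-const a zero    v = refl
segment-const a (suc n) v = cong (v ∷_) (segment-const (suc a) n v)

segment-++ : ∀ g a p q → segment g a (p + q) ≡ segment g a p ++ segment g (a + p) q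
segment-++ g a zero    q = cong (λ b → segment g b q) (sym (+-identityʳ a))
segment-++ g a (suc p) q = cong (g (suc a) ∷_)
  (trans (segment-++ g (suc a) p q) (cong (λ b → segment g (suc a) p ++ segment g b q) (sym (+-suc a p))))

segment-+ : ∀ g k a n → segment (λ t → g (t + k)) a n ≡ segment g (a + k) n
segment-+ g k a zero    = refl
segment-+ g k a (suc n) = cong (g (suc a + k) ∷_) (segment-+ g k (suc a) n)

segment-All : ∀ {P : ℕ → Set} {g} a n → (∀ t → a < t → P (g t)) → All P (segment g a n)
segment-All a zero    p = []
segment-All a (suc n) p = p (suc a) ≤-refl ∷ segment-All (suc a) n λ t a+1<t → p t (<⇒≤ a+1<t)

segment-pick : ∀ g a n t → a < t → t ≤ a + n →
  segment g a n ≡ segment g a (t ∸ suc a) ++ g t ∷ segment g t (a + n ∸ t)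
segment-pick g a n t a<t t≤a+n with m≤n⇒∃[o]m+o≡n a<t | m≤n⇒∃[o]m+o≡n t≤a+n
... | p , refl | q , a+n≡ = begin
  segment g a n
    ≡⟨ cong (segment g a) n≡ ⟩
  segment g a (p + suc q)
    ≡⟨ segment-++ g a p (suc q) ⟩
  segment g a p ++ g (suc (a + p)) ∷ segment g (suc (a + p)) q
    ≡⟨ cong₂ (λ u v → segment g a u ++ g (suc (a + p)) ∷ segment g (suc (a + p)) v)
             (sym (m+n∸m≡n (suc a) p)) (sym (m+n∸m≡n (suc a + p) q)) ⟩
  segment g a (suc a + p ∸ suc a) ++ g (suc (a + p)) ∷ segment g (suc (a + p)) (suc a + p + q ∸ suc (a + p))
    ≡⟨ cong (λ s → segment g a (suc a + p ∸ suc a) ++ g (suc (a + p)) ∷ segment g (suc (a + p)) (s ∸ suc (a + p)))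
            a+n≡ ⟩
  segment g a (suc a + p ∸ suc a) ++ g (suc (a + p)) ∷ segment g (suc (a + p)) (a + n ∸ suc (a + p))  ∎
  where
  open ≡-Reasoning
  rearrange : ∀ a p q → suc a + p + q ≡ a + (p + suc q)
  rearrange = solve-∀
  n≡ : n ≡ p + suc q
  n≡ = +-cancelˡ-≡ a n (p + suc q) (begin
    a + n              ≡⟨ a+n≡ ⟨
    suc a + p + q      ≡⟨ rearrange a p q ⟩
    a + (p + suc q)    ∎)

colourSum-zeros : ∀ B {Y} → All (_≡ 0) Y → ∀ π → colourSum B Y π ≡ weightProd B π
colourSum-zeros B []          π = refl
colourSum-zeros B (refl ∷ Y≡0) π = colourSum-zeros B Y≡0 π

colourSum-replicate-1 : ∀ B x Y π → colourSum B (replicate x 1 ++ Y) π ≡ colourSum B Y (addAt 1 x π)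
colourSum-replicate-1 B zero    Y π = refl
colourSum-replicate-1 B (suc x) Y π = colourSum-replicate-1 B x Y (incAt 1 π)

conjugate : List ℕ → ℕ → List ℕ
conjugate xs N = segment (conj xs) 0 N

-- Below the smallest part r every column of the conjugate has full height.
segment-conj-split : ∀ {r N} xs k → All (r ≤_) xs → k ≤ r → r ≤ N →
  segment (conj xs) k (N ∸ k) ≡ replicate (r ∸ k) (length xs) ++ segment (conj xs) r (N ∸ r)
segment-conj-split {r} {N} xs k r≤xs k≤r r≤N = begin
  segment (conj xs) k (N ∸ k)
    ≡⟨ cong (segment (conj xs) k) (trans (cong (_∸ k) (sym (m+[n∸m]≡n r≤N))) (+-∸-comm (N ∸ r) k≤r)) ⟩
  segment (conj xs) k ((r ∸ k) + (N ∸ r))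
    ≡⟨ segment-++ (conj xs) k (r ∸ k) (N ∸ r) ⟩
  segment (conj xs) k (r ∸ k) ++ segment (conj xs) (k + (r ∸ k)) (N ∸ r)
    ≡⟨ cong₂ _++_ full (cong (λ a → segment (conj xs) a (N ∸ r)) (m+[n∸m]≡n k≤r)) ⟩
  replicate (r ∸ k) (length xs) ++ segment (conj xs) r (N ∸ r)  ∎
  where
  open ≡-Reasoning
  full : segment (conj xs) k (r ∸ k) ≡ replicate (r ∸ k) (length xs)
  full = trans
    (segment-cong k (r ∸ k) λ t _ t≤ → conj-all-≥ (All.map (≤-trans (subst (t ≤_) (m+[n∸m]≡n k≤r) t≤)) r≤xs))
    (segment-const k (r ∸ k) (length xs))

conjugate-minusHat : ∀ xs k N → conjugate (minusHat xs k) (N ∸ k) ≡ segment (conj xs) k (N ∸ k)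
conjugate-minusHat xs k N =
  trans (segment-cong 0 (N ∸ k) λ t 0<t _ → conj-minusHat xs k 0<t) (segment-+ (conj xs) k 0 (N ∸ k))

conjugate-dropLast : ∀ x xs {N} → NonIncreasing (x ∷ xs) → lastPart (x ∷ xs) ≤ N →
  let r = lastPart (x ∷ xs) in
  conjugate (x ∷ xs) N ≡ replicate r (length (x ∷ xs)) ++ segment (conj (dropLast (x ∷ xs))) r (N ∸ r)
conjugate-dropLast x xs {N} decr r≤N = trans (segment-conj-split (x ∷ xs) 0 (lastPart-≤ decr) z≤n r≤N)
  (cong (replicate r (length (x ∷ xs)) ++_) (segment-cong r (N ∸ r) λ t r<t _ →
    trans (conj-dropLast x xs t) (trans (cong (conj (dropLast (x ∷ xs)) t +_) (atLeast-> r<t)) (+-identityʳ _))))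
  where r = lastPart (x ∷ xs)

-- The recursion defining f, read on the conjugate: removing the last part r turns the r columns of
-- full height R into columns of height R - 1, each of which may first have taken the colour R.
fFuel≡colourSum-conjugate : ∀ m xs → length xs ≤ suc m → NonIncreasing xs →
  ∀ {N} → All (_≤ N) xs → ∀ {B} → length xs ≤ B → fFuel m xs ≡ colourSum B (conjugate xs N) 0̇
fFuel≡colourSum-conjugate m [] _ _ {N} _ {B} _ =
  sym (trans (colourSum-zeros B (segment-All 0 N λ _ _ → refl) _) (weightProd-0̇ B))
fFuel≡colourSum-conjugate m (x ∷ []) _ _ {N} (x≤N ∷ []) {B} 1≤B = sym (begin
  colourSum B (conjugate (x ∷ []) N) 0̇
    ≡⟨ cong (λ X → colourSum B X 0̇) (segment-conj-split (x ∷ []) 0 (≤-refl ∷ []) z≤n x≤N) ⟩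
  colourSum B (replicate x 1 ++ segment (conj (x ∷ [])) x (N ∸ x)) 0̇
    ≡⟨ colourSum-replicate-1 B x _ 0̇ ⟩
  colourSum B (segment (conj (x ∷ [])) x (N ∸ x)) (addAt 1 x 0̇)
    ≡⟨ colourSum-zeros B (segment-All x (N ∸ x) λ t x<t → trans (+-identityʳ _) (atLeast-> x<t)) _ ⟩
  weightProd B (addAt 1 x 0̇)
    ≡⟨ weightProd-only-colour1 B _ 1≤B (λ c 2≤c → addAt-≢ 1 x 0̇ (≢-sym (<⇒≢ 2≤c))) ⟩
  d (addAt 1 x 0̇ 1)
    ≡⟨ cong d (trans (addAt-≡ 1 x 0̇) (+-identityʳ x)) ⟩
  d x  ∎)
  where
  open ≡-Reasoning
fFuel≡colourSum-conjugate zero (x ∷ y ∷ ys) (s≤s ()) _ _ _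
fFuel≡colourSum-conjugate (suc m) xs@(x ∷ y ∷ ys) len≤ decr {N} xs≤N {B} len≤B = begin
  fFuel m ν + sumFrom1 r (λ k → (r C k) * oddDF k * fFuel m (minusHat ν k))
    ≡⟨ cong₂ _+_ IH-ν (sumFrom1-cong r λ k _ k≤r → IH-minusHat k k≤r) ⟩
  sumFrom0 r (λ k → (r C k) * (oddDF k * colourSum B (lowered k) 0̇))
    ≡⟨ sumFrom0-cong r (λ k _ → cong ((r C k) *_) (sym (colourSum-addAt B (lowered k) k 0̇
         (s≤s (s≤s z≤n)) R≤B (lowered<R k) refl))) ⟩
  sumFrom0 r (λ k → (r C k) * colourSum B (lowered k) (addAt R k 0̇))
    ≡⟨ colourSum-replicate-top B r′ r Y 0̇ ⟨
  colourSum B (replicate r R ++ Y) 0̇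
    ≡⟨ cong (λ X → colourSum B X 0̇) conjugate-xs ⟨
  colourSum B (conjugate xs N) 0̇  ∎
  where
  open ≡-Reasoning
  ν = dropLast xs
  r = lastPart xs
  r′ = length (dropLast (y ∷ ys))
  R = suc (suc r′)
  Y = segment (conj ν) r (N ∸ r)
  lowered : ℕ → List ℕ
  lowered k = replicate (r ∸ k) (suc r′) ++ Y
  length≡ : length xs ≡ R
  length≡ = cong suc (sym (length-dropLast y ys))
  R≤B : R ≤ B
  R≤B = subst (_≤ B) length≡ len≤B
  lenν≤ : length ν ≤ suc m
  lenν≤ = s≤s⁻¹ (subst (_≤ suc (suc m)) length≡ len≤)
  lenν≤B : length ν ≤ B
  lenν≤B = ≤-trans (n≤1+n _) R≤B
  decrν : NonIncreasing ν
  decrν = NonIncreasing-dropLast decr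
  ν≤N : All (_≤ N) ν
  ν≤N = All-dropLast xs≤N
  r≤ν : All (r ≤_) ν
  r≤ν = All-dropLast (lastPart-≤ decr)
  r≤N : r ≤ N
  r≤N = All-lastPart xs≤N
  lowered<R : ∀ k → All (_< R) (lowered k)
  lowered<R k = AllP.++⁺ (AllP.replicate⁺ (r ∸ k) ≤-refl) (segment-All r (N ∸ r) λ t _ → s≤s (conj-≤-length ν t))
  conjugate-xs : conjugate xs N ≡ replicate r R ++ Y
  conjugate-xs = trans (conjugate-dropLast x (y ∷ ys) decr r≤N) (cong (λ L → replicate r L ++ Y) length≡)
  IH-ν : fFuel m ν ≡ (r C 0) * (oddDF 0 * colourSum B (lowered 0) 0̇)
  IH-ν = trans (fFuel≡colourSum-conjugate m ν lenν≤ decrν ν≤N lenν≤B) (trans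
    (cong (λ X → colourSum B X 0̇) (segment-conj-split ν 0 r≤ν z≤n r≤N))
    (sym (trans (*-identityˡ _) (*-identityˡ _))))
  IH-minusHat : ∀ k → k ≤ r →
    (r C k) * oddDF k * fFuel m (minusHat ν k) ≡ (r C k) * (oddDF k * colourSum B (lowered k) 0̇)
  IH-minusHat k k≤r = trans (*-assoc (r C k) (oddDF k) _) (cong (λ v → (r C k) * (oddDF k * v)) (begin
    fFuel m (minusHat ν k)
      ≡⟨ fFuel≡colourSum-conjugate m (minusHat ν k) (≤-trans (length-minusHat ν k) lenν≤)
           (NonIncreasing-minusHat k decrν) (All-minusHat k ν≤N) (≤-trans (length-minusHat ν k) lenν≤B) ⟩
    colourSum B (conjugate (minusHat ν k) (N ∸ k)) 0̇
      ≡⟨ cong (λ X → colourSum B X 0̇) (trans (conjugate-minusHat ν k N) (segment-conj-split ν k r≤ν k≤r r≤N)) ⟩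
    colourSum B (lowered k) 0̇  ∎))

f≡colourSum-conjugate : ∀ xs → NonIncreasing xs → ∀ {N} → All (_≤ N) xs → ∀ {B} → length xs ≤ B →
  f xs ≡ colourSum B (conjugate xs N) 0̇
f≡colourSum-conjugate xs = fFuel≡colourSum-conjugate (length xs) xs (n≤1+n _)

-- Parts of a partition

All-at : ∀ {P : ℕ → Set} {xs k} → All P xs → 1 ≤ k → k ≤ length xs → P (at xs k)
All-at {k = suc zero}    (px ∷ _)  _ _         = px
All-at {k = suc (suc k)} (_ ∷ pxs) _ (s≤s k≤) = All-at pxs (s≤s z≤n) k≤

All-≤-sum : ∀ xs → All (_≤ sum xs) xs
All-≤-sum []       = []
All-≤-sum (x ∷ xs) = m≤m+n x (sum xs) ∷ All.map (λ y≤ → ≤-trans y≤ (m≤n+m (sum xs) x)) (All-≤-sum xs)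

length-≤-sum : ∀ {xs} → All (0 <_) xs → length xs ≤ sum xs
length-≤-sum []         = z≤n
length-≤-sum (x>0 ∷ xs>0) = +-mono-≤ x>0 (length-≤-sum xs>0)

at-beyond : ∀ xs {k} → length xs < k → at xs k ≡ 0
at-beyond []       _               = refl
at-beyond (x ∷ xs) {suc (suc k)} (s≤s len<) = at-beyond xs len<

at-suc-≤ : ∀ {xs} a → NonIncreasing xs → 1 ≤ a → at xs (suc a) ≤ at xs a
at-suc-≤ {[]}              a          _          _ = z≤n
at-suc-≤ {x ∷ []}          (suc zero) _          _ = z≤n
at-suc-≤ {x ∷ y ∷ ys}      (suc zero) (y≤x ∷ _)  _ = y≤x
at-suc-≤ {x ∷ xs}          (suc (suc a)) decr    _ = at-suc-≤ (suc a) (Linked.tail decr) (s≤s z≤n)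

at-antitone : ∀ {xs a b} → NonIncreasing xs → 1 ≤ a → a ≤ b → at xs b ≤ at xs a
at-antitone {xs} {a} decr 1≤a a≤b with m≤n⇒∃[o]m+o≡n a≤b
... | k , refl = go k
  where
  go : ∀ k → at xs (a + k) ≤ at xs a
  go zero    = ≤-reflexive (cong (at xs) (+-identityʳ a))
  go (suc k) = ≤-trans (≤-reflexive (cong (at xs) (+-suc a k)))
                       (≤-trans (at-suc-≤ (a + k) decr (≤-trans 1≤a (m≤m+n a k))) (go k))

≤-conj : ∀ {xs} → NonIncreasing xs → ∀ k {t} → 1 ≤ k → 1 ≤ t → t ≤ at xs k → k ≤ conj xs t
≤-conj {[]}     _    k             _ 1≤t t≤ = contradiction (≤-trans 1≤t t≤) λ ()
≤-conj {x ∷ xs} _    (suc zero)    _ _   t≤ = ≤-trans (≤-reflexive (sym (atLeast-≤ t≤))) (m≤m+n _ _)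
≤-conj {x ∷ xs} decr (suc (suc k)) _ 1≤t t≤ = subst (suc (suc k) ≤_)
  (cong (_+ conj xs _) (sym (atLeast-≤ (≤-trans t≤ (at-antitone {b = suc (suc k)} decr (s≤s z≤n) (s≤s z≤n))))))
  (s≤s (≤-conj (Linked.tail decr) (suc k) (s≤s z≤n) 1≤t t≤))

conj-≤ : ∀ {xs} → NonIncreasing xs → ∀ k {t} → at xs (suc k) < t → conj xs t ≤ k
conj-≤ {[]}     _    k       _   = z≤n
conj-≤ {x ∷ xs} decr zero    x<t =
  ≤-reflexive (conj-all-< (x<t ∷ All.map (λ y≤x → ≤-<-trans y≤x x<t) (NonIncreasing-head decr)))
conj-≤ {x ∷ xs} decr (suc k) lt  = +-mono-≤ (atLeast-≤1 _ x) (conj-≤ (Linked.tail decr) k lt)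

length-modifyAt : ∀ k g xs → length (modifyAt k g xs) ≡ length xs
length-modifyAt k             g []       = refl
length-modifyAt zero          g (x ∷ xs) = refl
length-modifyAt (suc zero)    g (x ∷ xs) = refl
length-modifyAt (suc (suc k)) g (x ∷ xs) = cong suc (length-modifyAt (suc k) g xs)

at-modifyAt-≢ : ∀ k g xs {t} → t ≢ k → at (modifyAt k g xs) t ≡ at xs t
at-modifyAt-≢ k             g []       t≢k = refl
at-modifyAt-≢ zero          g (x ∷ xs) t≢k = refl
at-modifyAt-≢ (suc zero)    g (x ∷ xs) {zero}          t≢k = refl
at-modifyAt-≢ (suc zero)    g (x ∷ xs) {suc zero}      t≢k = contradiction refl t≢k
at-modifyAt-≢ (suc zero)    g (x ∷ xs) {suc (suc t)}   t≢k = refl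
at-modifyAt-≢ (suc (suc k)) g (x ∷ xs) {zero}          t≢k = refl
at-modifyAt-≢ (suc (suc k)) g (x ∷ xs) {suc zero}      t≢k = refl
at-modifyAt-≢ (suc (suc k)) g (x ∷ xs) {suc (suc t)}   t≢k = at-modifyAt-≢ (suc k) g xs (t≢k ∘ cong suc)

at-≤-modifyAt-suc : ∀ k xs t → at xs t ≤ at (modifyAt k suc xs) t
at-≤-modifyAt-suc k xs t with t ≟ k
... | no t≢k = ≤-reflexive (sym (at-modifyAt-≢ k suc xs t≢k))
... | yes refl = go k xs
  where
  go : ∀ k xs → at xs k ≤ at (modifyAt k suc xs) k
  go k             []       = z≤n
  go zero          (x ∷ xs) = z≤n
  go (suc zero)    (x ∷ xs) = n≤1+n x
  go (suc (suc k)) (x ∷ xs) = go (suc k) xs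

conj-modifyAt : ∀ k g xs t → 1 ≤ k → k ≤ length xs →
  conj (modifyAt k g xs) t + atLeast t (at xs k) ≡ conj xs t + atLeast t (g (at xs k))
conj-modifyAt (suc zero)    g (x ∷ xs) t _ _ = swap (atLeast t (g x)) (conj xs t) (atLeast t x)
  where
  swap : ∀ a b c → a + b + c ≡ c + b + a
  swap = solve-∀
conj-modifyAt (suc (suc k)) g (x ∷ xs) t _ (s≤s k≤) = begin
  atLeast t x + conj (modifyAt (suc k) g xs) t + atLeast t (at xs (suc k))
    ≡⟨ +-assoc (atLeast t x) _ _ ⟩
  atLeast t x + (conj (modifyAt (suc k) g xs) t + atLeast t (at xs (suc k)))
    ≡⟨ cong (atLeast t x +_) (conj-modifyAt (suc k) g xs t (s≤s z≤n) k≤) ⟩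
  atLeast t x + (conj xs t + atLeast t (g (at xs (suc k))))
    ≡⟨ +-assoc (atLeast t x) _ _ ⟨
  atLeast t x + conj xs t + atLeast t (g (at xs (suc k)))  ∎
  where open ≡-Reasoning

All-modifyAt : ∀ {P Q : ℕ → Set} k g {xs} → (∀ {x} → P x → Q (g x)) → (∀ {x} → P x → Q x) → All P xs →
  All Q (modifyAt k g xs)
All-modifyAt k             g P⇒Qg P⇒Q []         = []
All-modifyAt zero          g P⇒Qg P⇒Q ps@(_ ∷ _) = All.map P⇒Q ps
All-modifyAt (suc zero)    g P⇒Qg P⇒Q (p ∷ ps)   = P⇒Qg p ∷ All.map P⇒Q ps
All-modifyAt (suc (suc k)) g P⇒Qg P⇒Q (p ∷ ps)   = P⇒Q p ∷ All-modifyAt (suc k) g P⇒Qg P⇒Q ps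

NonIncreasing-modifyAt : ∀ {xs} k g → NonIncreasing xs → 1 ≤ k →
  (2 ≤ k → g (at xs k) ≤ at xs (k ∸ 1)) → at xs (suc k) ≤ g (at xs k) → NonIncreasing (modifyAt k g xs)
NonIncreasing-modifyAt {[]}         k                   g _          _ _  _  = []
NonIncreasing-modifyAt {x ∷ []}     (suc zero)          g _          _ _  _  = [-]
NonIncreasing-modifyAt {x ∷ _ ∷ _}  (suc zero)          g (_ ∷ rest) _ _  ≤g = ≤g ∷ rest
NonIncreasing-modifyAt {x ∷ []}     (suc (suc k))       g _          _ _  _  = [-]
NonIncreasing-modifyAt {x ∷ _ ∷ _}  (suc (suc zero))    g (_ ∷ rest) _ g≤ ≤g =
  g≤ (s≤s (s≤s z≤n)) ∷ NonIncreasing-modifyAt 1 g rest (s≤s z≤n) (λ { (s≤s ()) }) ≤g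
NonIncreasing-modifyAt {x ∷ _ ∷ _}  (suc (suc (suc k))) g (y≤x ∷ rest) _ g≤ ≤g =
  y≤x ∷ NonIncreasing-modifyAt (suc (suc k)) g rest (s≤s z≤n) (λ _ → g≤ (s≤s (s≤s z≤n))) ≤g

segmentWithout : (ℕ → ℕ) → ℕ → ℕ → ℕ → List ℕ
segmentWithout g q p N = segment g 0 (q ∸ 1) ++ segment g q (p ∸ suc q) ++ segment g p (N ∸ p)

segmentWithout-cong : ∀ {g h q p} N → 1 ≤ q → q < p → (∀ t → 1 ≤ t → t ≢ q → t ≢ p → g t ≡ h t) →
  segmentWithout g q p N ≡ segmentWithout h q p N
segmentWithout-cong {q = q} {p} N 1≤q q<p g≡h = cong₂ _++_
  (segment-cong 0 (q ∸ 1) λ t 0<t t≤ → let t<q = m≤pred[n]⇒suc[m]≤n {{>-nonZero 1≤q}} t≤ in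
     g≡h t 0<t (<⇒≢ t<q) (<⇒≢ (<-trans t<q q<p)))
  (cong₂ _++_
    (segment-cong q (p ∸ suc q) λ t q<t t≤ → let t<p = subst (suc t ≤_) (m+[n∸m]≡n q<p) (s≤s t≤) in
      g≡h t (≤-trans (s≤s z≤n) q<t) (≢-sym (<⇒≢ q<t)) (<⇒≢ t<p))
    (segment-cong p (N ∸ p) λ t p<t _ →
      g≡h t (≤-trans (s≤s z≤n) p<t) (≢-sym (<⇒≢ (<-trans q<p p<t))) (≢-sym (<⇒≢ p<t))))

↭-pick₂ : ∀ {x y : ℕ} A M C → A ++ x ∷ M ++ y ∷ C ↭ x ∷ y ∷ A ++ M ++ C
↭-pick₂ {x} {y} A M C = ↭-trans (↭-shift x A (M ++ y ∷ C)) (↭-prep x (↭-trans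
  (↭-reflexive (sym (++-assoc A M (y ∷ C))))
  (↭-trans (↭-shift y (A ++ M) C) (↭-prep y (↭-reflexive (++-assoc A M C))))))

colourSum-segment-pick₂ : ∀ B g {q p N} π → 1 ≤ q → q < p → p ≤ N →
  colourSum B (segment g 0 N) π ≡ colourSum B (g q ∷ g p ∷ segmentWithout g q p N) π
colourSum-segment-pick₂ B g {q} {p} {N} π 1≤q q<p p≤N = trans
  (cong (λ X → colourSum B X π) (begin
    segment g 0 N
      ≡⟨ segment-pick g 0 N q 1≤q q≤N ⟩
    A ++ g q ∷ segment g q (N ∸ q)
      ≡⟨ cong (λ X → A ++ g q ∷ X) (segment-pick g q (N ∸ q) p q<p (subst (p ≤_) (sym (m+[n∸m]≡n q≤N)) p≤N)) ⟩
    A ++ g q ∷ M ++ g p ∷ segment g p (q + (N ∸ q) ∸ p)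
      ≡⟨ cong (λ n → A ++ g q ∷ M ++ g p ∷ segment g p (n ∸ p)) (m+[n∸m]≡n q≤N) ⟩
    A ++ g q ∷ M ++ g p ∷ C  ∎))
  (colourSum-↭ B (↭-pick₂ A M C) π)
  where
  open ≡-Reasoning
  q≤N = ≤-trans (<⇒≤ q<p) p≤N
  A = segment g 0 (q ∸ 1)
  M = segment g q (p ∸ suc q)
  C = segment g p (N ∸ p)

-- The shift μ(i,j)

-- Only λ′ at μ_i + 1 and at μ_j change; the compensating terms sit on both sides to avoid subtraction.
conj-shift : ∀ μ {i j} t → 1 ≤ i → i < j → j ≤ length μ → 1 ≤ t →
  conj (shift μ i j) t + atLeast t (at μ j) + atLeast t (at μ i)
    ≡ conj μ t + atLeast t (suc (at μ i)) + atLeast t (at μ j ∸ 1)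
conj-shift μ {i} {j} t 1≤i i<j j≤len 1≤t = begin
  conj (shift μ i j) t + atLeast t (at μ j) + atLeast t (at μ i)
    ≡⟨ cong (λ c → c + atLeast t (at μ j) + atLeast t (at μ i)) (conj-dropZeros μ₂ 1≤t) ⟩
  conj μ₂ t + atLeast t (at μ j) + atLeast t (at μ i)
    ≡⟨ cong (λ v → conj μ₂ t + atLeast t v + atLeast t (at μ i)) μ₁j≡ ⟨
  conj μ₂ t + atLeast t (at μ₁ j) + atLeast t (at μ i)
    ≡⟨ cong (_+ atLeast t (at μ i)) (conj-modifyAt j (_∸ 1) μ₁ t (≤-trans 1≤i (<⇒≤ i<j))
         (subst (j ≤_) (sym (length-modifyAt i suc μ)) j≤len)) ⟩
  conj μ₁ t + atLeast t (at μ₁ j ∸ 1) + atLeast t (at μ i)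
    ≡⟨ +-CS.xy∙z≈xz∙y (conj μ₁ t) _ _ ⟩
  conj μ₁ t + atLeast t (at μ i) + atLeast t (at μ₁ j ∸ 1)
    ≡⟨ cong₂ _+_ (conj-modifyAt i suc μ t 1≤i (≤-trans (<⇒≤ i<j) j≤len))
                 (cong (λ v → atLeast t (v ∸ 1)) μ₁j≡) ⟩
  conj μ t + atLeast t (suc (at μ i)) + atLeast t (at μ j ∸ 1)  ∎
  where
  open ≡-Reasoning
  μ₁ = modifyAt i suc μ
  μ₂ = modifyAt j (_∸ 1) μ₁
  μ₁j≡ : at μ₁ j ≡ at μ j
  μ₁j≡ = at-modifyAt-≢ i suc μ (≢-sym (<⇒≢ i<j))

length-shift : ∀ μ i j → length (shift μ i j) ≤ length μ
length-shift μ i j = ≤-trans (length-filter (λ x → ¬? (x ≟ 0)) (modifyAt j (_∸ 1) (modifyAt i suc μ)))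
  (≤-reflexive (trans (length-modifyAt j (_∸ 1) (modifyAt i suc μ)) (length-modifyAt i suc μ)))

All-shift : ∀ {N μ} i j → All (_≤ N) μ → All (_≤ suc N) (shift μ i j)
All-shift i j μ≤N = AllP.filter⁺ (λ x → ¬? (x ≟ 0))
  (All-modifyAt j (_∸ 1) (λ x≤ → ≤-trans (m∸n≤m _ 1) x≤) (λ x≤ → x≤)
    (All-modifyAt i suc s≤s m≤n⇒m≤1+n μ≤N))

NonIncreasing-shift : ∀ {μ} a b → NonIncreasing μ → a < b →
  at μ (suc (suc a)) < at μ (suc a) →
  (suc (suc b) < length μ → at μ (suc (suc (suc b))) < at μ (suc (suc b))) →
  NonIncreasing (shift μ (suc (suc a)) (suc (suc b)))
NonIncreasing-shift {μ} a b decr a<b μi<μi-1 μj+1<μj =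
  Linked.filter⁺ (λ x → ¬? (x ≟ 0)) (λ z≤y y≤x → ≤-trans y≤x z≤y)
    (NonIncreasing-modifyAt j (_∸ 1) decr₁ (s≤s z≤n) pred-ok succ-ok)
  where
  i = suc (suc a)
  j = suc (suc b)
  μ₁ = modifyAt i suc μ
  decr₁ : NonIncreasing μ₁
  decr₁ = NonIncreasing-modifyAt i suc decr (s≤s z≤n) (λ _ → μi<μi-1)
    (≤-trans (at-suc-≤ i decr (s≤s z≤n)) (n≤1+n _))
  μ₁-≢i : ∀ {t} → i < t → at μ₁ t ≡ at μ t
  μ₁-≢i i<t = at-modifyAt-≢ i suc μ (≢-sym (<⇒≢ i<t))
  i<j : i < j
  i<j = s≤s (s≤s a<b)
  pred-ok : 2 ≤ j → at μ₁ j ∸ 1 ≤ at μ₁ (suc b)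
  pred-ok _ = begin
    at μ₁ j ∸ 1      ≤⟨ m∸n≤m _ 1 ⟩
    at μ₁ j          ≡⟨ μ₁-≢i i<j ⟩
    at μ j           ≤⟨ at-antitone decr (s≤s z≤n) (n≤1+n (suc b)) ⟩
    at μ (suc b)     ≤⟨ at-≤-modifyAt-suc i μ (suc b) ⟩
    at μ₁ (suc b)    ∎
    where open ≤-Reasoning
  succ-ok : at μ₁ (suc j) ≤ at μ₁ j ∸ 1
  succ-ok rewrite μ₁-≢i (m<n⇒m<1+n i<j) | μ₁-≢i i<j with j <? length μ
  ... | yes j<len = <⇒≤pred (μj+1<μj j<len)
  ... | no  j≮len = subst (_≤ at μ j ∸ 1) (sym (at-beyond μ (s≤s (≮⇒≥ j≮len)))) z≤n

segment-uncons : ∀ g a {n} → 1 ≤ n → segment g a n ≡ g (suc a) ∷ segment g (suc a) (n ∸ 1)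
segment-uncons g a {suc n} _ = refl

nonzeros-zeros : ∀ {Y} → All (_≡ 0) Y → nonzeros Y ≡ 0
nonzeros-zeros []             = refl
nonzeros-zeros (refl ∷ Y≡0) = nonzeros-zeros Y≡0

nonzeros-≥2 : ∀ {x y} Y → 1 ≤ x → 1 ≤ y → 2 ≤ nonzeros (x ∷ y ∷ Y)
nonzeros-≥2 {suc _} {suc _} Y _ _ = s≤s (s≤s z≤n)

module ShiftComparison (n : ℕ) (μ : List ℕ) (a b : ℕ) (pos : All (0 <_) μ) (decr : NonIncreasing μ)
  (sum≡n : sum μ ≡ n) (a<b : a < b) (j≤len : suc (suc b) ≤ length μ)
  (μi<μi-1 : at μ (suc (suc a)) < at μ (suc a))
  (μj+1<μj : suc (suc b) < length μ → at μ (suc (suc (suc b))) < at μ (suc (suc b))) where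

  private
    i = suc (suc a)
    j = suc (suc b)
    μ′ = shift μ i j
    N = suc n
    B = length μ
    μi = at μ i
    q = at μ j
    p = suc μi
    g = conj μ
    g′ = conj μ′

    i<j : i < j
    i<j = s≤s (s≤s a<b)
    1≤i : 1 ≤ i
    1≤i = s≤s z≤n
    1≤j : 1 ≤ j
    1≤j = s≤s z≤n
    1≤q : 1 ≤ q
    1≤q = All-at pos 1≤j j≤len
    q≤μi : q ≤ μi
    q≤μi = at-antitone decr 1≤i (<⇒≤ i<j)
    q<p : q < p
    q<p = s≤s q≤μi
    μ≤n : All (_≤ n) μ
    μ≤n = subst (λ s → All (_≤ s) μ) sum≡n (All-≤-sum μ)
    p≤N : p ≤ N
    p≤N = s≤s (All-at μ≤n 1≤i (≤-trans (<⇒≤ i<j) j≤len))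

    conj-shift-at : ∀ t → 1 ≤ t →
      g′ t + atLeast t q + atLeast t μi ≡ g t + atLeast t p + atLeast t (q ∸ 1)
    conj-shift-at t = conj-shift μ t 1≤i i<j j≤len

    g′-other : ∀ t → 1 ≤ t → t ≢ q → t ≢ p → g′ t ≡ g t
    g′-other t 1≤t t≢q t≢p = +-cancelʳ-≡ (atLeast t q + atLeast t μi) (g′ t) (g t) (begin
      g′ t + (atLeast t q + atLeast t μi)    ≡⟨ +-assoc (g′ t) _ _ ⟨
      g′ t + atLeast t q + atLeast t μi      ≡⟨ conj-shift-at t 1≤t ⟩
      g t + atLeast t p + atLeast t (q ∸ 1)  ≡⟨ cong₂ (λ u v → g t + u + v) (atLeast-suc t≢p) (atLeast-pred 1≤q t≢q) ⟩
      g t + atLeast t μi + atLeast t q       ≡⟨ +-CS.xy∙z≈x∙zy (g t) _ _ ⟩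
      g t + (atLeast t q + atLeast t μi)     ∎)
      where open ≡-Reasoning

    g-p : g p ≡ suc a
    g-p = ≤-antisym (conj-≤ decr (suc a) (n<1+n μi)) (≤-conj decr (suc a) (s≤s z≤n) (s≤s z≤n) μi<μi-1)

    g-q : g q ≡ j
    g-q = ≤-antisym (conj-≤ decr j μj+1<q) (≤-conj decr j 1≤j 1≤q ≤-refl)
      where
      μj+1<q : at μ (suc j) < q
      μj+1<q with j <? length μ
      ... | yes j<len = μj+1<μj j<len
      ... | no  j≮len = subst (_< q) (sym (at-beyond μ (s≤s (≮⇒≥ j≮len)))) 1≤q

    g′-p : g′ p ≡ i
    g′-p = begin
      g′ p                                   ≡⟨ +0+0 (g′ p) ⟨
      g′ p + 0 + 0                           ≡⟨ cong₂ (λ u v → g′ p + u + v) (atLeast-> q<p) (atLeast-> (n<1+n μi)) ⟨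
      g′ p + atLeast p q + atLeast p μi      ≡⟨ conj-shift-at p (s≤s z≤n) ⟩
      g p + atLeast p p + atLeast p (q ∸ 1)  ≡⟨ cong₂ (λ u v → u + atLeast p p + v) g-p
                                                    (atLeast-> (≤-<-trans (m∸n≤m q 1) q<p)) ⟩
      suc a + atLeast p p + 0                ≡⟨ cong (λ u → suc a + u + 0) (atLeast-≤ ≤-refl) ⟩
      suc a + 1 + 0                          ≡⟨ +1+0 (suc a) ⟩
      i                                      ∎
      where
      open ≡-Reasoning
      +0+0 : ∀ x → x + 0 + 0 ≡ x
      +0+0 = solve-∀
      +1+0 : ∀ x → x + 1 + 0 ≡ suc x
      +1+0 = solve-∀

    g′-q : g′ q ≡ suc b
    g′-q = suc-injective (suc-injective (begin
      suc (suc (g′ q))                       ≡⟨ +1+1 (g′ q) ⟨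
      g′ q + 1 + 1                           ≡⟨ cong₂ (λ u v → g′ q + u + v) (atLeast-≤ ≤-refl) (atLeast-≤ q≤μi) ⟨
      g′ q + atLeast q q + atLeast q μi      ≡⟨ conj-shift-at q 1≤q ⟩
      g q + atLeast q p + atLeast q (q ∸ 1)  ≡⟨ cong₂ (λ u v → u + atLeast q p + v) g-q
                                                    (atLeast-> (∸-monoʳ-< {o = 0} (s≤s z≤n) 1≤q)) ⟩
      j + atLeast q p + 0                    ≡⟨ cong (λ u → j + u + 0) (atLeast-≤ (<⇒≤ q<p)) ⟩
      j + 1 + 0                              ≡⟨ +1+0 j ⟩
      suc j                                  ∎))
      where
      open ≡-Reasoning
      +1+1 : ∀ x → x + 1 + 1 ≡ suc (suc x)
      +1+1 = solve-∀
      +1+0 : ∀ x → x + 1 + 0 ≡ suc x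
      +1+0 = solve-∀

    -- In the conjugate, μ and μ′ differ only in the columns q = μ_j and p = μ_i + 1.
    Z = segmentWithout g q p N
    E = colourSum B Z (incAt i (incAt i 0̇))

    colourSum-μ : f μ ≡ colourSum B (j ∷ suc a ∷ Z) 0̇
    colourSum-μ = begin
      f μ                                   ≡⟨ f≡colourSum-conjugate μ decr (All.map m≤n⇒m≤1+n μ≤n) ≤-refl ⟩
      colourSum B (conjugate μ N) 0̇         ≡⟨ colourSum-segment-pick₂ B g 0̇ 1≤q q<p p≤N ⟩
      colourSum B (g q ∷ g p ∷ Z) 0̇         ≡⟨ cong₂ (λ u v → colourSum B (u ∷ v ∷ Z) 0̇) g-q g-p ⟩
      colourSum B (j ∷ suc a ∷ Z) 0̇         ∎
      where open ≡-Reasoning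

    colourSum-μ′ : f μ′ ≡ colourSum B (suc b ∷ i ∷ Z) 0̇
    colourSum-μ′ = begin
      f μ′
        ≡⟨ f≡colourSum-conjugate μ′ (NonIncreasing-shift a b decr a<b μi<μi-1 μj+1<μj)
             (All-shift i j μ≤n) (length-shift μ i j) ⟩
      colourSum B (conjugate μ′ N) 0̇        ≡⟨ colourSum-segment-pick₂ B g′ 0̇ 1≤q q<p p≤N ⟩
      colourSum B (g′ q ∷ g′ p ∷ segmentWithout g′ q p N) 0̇
        ≡⟨ cong₂ (λ u v → colourSum B (u ∷ v) 0̇) g′-q
                 (cong₂ _∷_ g′-p (segmentWithout-cong N 1≤q q<p g′-other)) ⟩
      colourSum B (suc b ∷ i ∷ Z) 0̇         ∎
      where open ≡-Reasoning

    f-shift-+E : f μ + E ≤ f μ′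
    f-shift-+E = subst₂ (λ u v → u + E ≤ v) (sym colourSum-μ) (sym colourSum-μ′)
      (colourSum-shift-≥ B Z 0̇ a<b j≤len z≤n)

  f-shift-≥ : f μ ≤ f μ′
  f-shift-≥ = ≤-trans (m≤m+n (f μ) E) f-shift-+E

  private
    3≤n : 3 ≤ n
    3≤n = ≤-trans (s≤s (s≤s (≤-trans (s≤s z≤n) a<b))) (≤-trans j≤len (subst (length μ ≤_) sum≡n (length-≤-sum pos)))

    -- Once μ_j = μ_i = 1, the remaining columns are λ′_3, λ′_4, …
    Z≡ : q ≡ 1 → μi ≡ 1 → Z ≡ segment g 2 (n ∸ 1)
    Z≡ q≡1 μi≡1 = cong₂ (λ q p → segmentWithout g q p N) q≡1 (cong suc μi≡1)

    1≤n∸1 : 1 ≤ n ∸ 1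
    1≤n∸1 = ∸-monoˡ-≤ 1 (≤-trans (s≤s (s≤s z≤n)) 3≤n)

    module Forward (Z≤1 : All (_≤ 1) Z) (nz≡1 : nonzeros Z ≡ 1) where

      q≡1 : q ≡ 1
      q≡1 with q ≤? 1
      ... | yes q≤1 = ≤-antisym q≤1 1≤q
      ... | no  q≰1 = contradiction (≤-trans (≤-trans (s≤s (s≤s z≤n)) j≤g1) g1≤1) λ { (s≤s ()) }
        where
        j≤g1 : j ≤ g 1
        j≤g1 = ≤-conj decr j 1≤j (s≤s z≤n) 1≤q
        g1≤1 : g 1 ≤ 1
        g1≤1 = All.head (subst (All (_≤ 1)) (segment-uncons g 0 (∸-monoˡ-≤ 1 (≰⇒> q≰1))) (AllP.++⁻ˡ _ Z≤1))

      μi≡q : μi ≡ q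
      μi≡q with μi ≟ q
      ... | yes μi≡q = μi≡q
      ... | no  μi≢q = contradiction (≤-trans (≤-trans (s≤s (s≤s z≤n)) i≤g) g≤1) λ { (s≤s ()) }
        where
        q<μi : q < μi
        q<μi = ≤∧≢⇒< q≤μi (≢-sym μi≢q)
        i≤g : i ≤ g (suc q)
        i≤g = ≤-conj decr i 1≤i (s≤s z≤n) q<μi
        g≤1 : g (suc q) ≤ 1
        g≤1 = All.head (subst (All (_≤ 1)) (segment-uncons g q (m<n⇒0<n∸m q<μi))
          (AllP.++⁻ˡ _ (AllP.++⁻ʳ (segment g 0 (q ∸ 1)) Z≤1)))

      μi≡1 : μi ≡ 1
      μi≡1 = trans μi≡q q≡1

      Z′≤1 : All (_≤ 1) (segment g 2 (n ∸ 1))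
      Z′≤1 = subst (All (_≤ 1)) (Z≡ q≡1 μi≡1) Z≤1

      nz′≡1 : nonzeros (segment g 2 (n ∸ 1)) ≡ 1
      nz′≡1 = subst (λ X → nonzeros X ≡ 1) (Z≡ q≡1 μi≡1) nz≡1

      μ1≡3 : at μ 1 ≡ 3
      μ1≡3 with at μ 1 ≤? 3 | 3 ≤? at μ 1
      ... | yes μ1≤3 | yes 3≤μ1 = ≤-antisym μ1≤3 3≤μ1
      ... | _        | no 3≰μ1 = contradiction (trans (sym nz′≡1) (nonzeros-zeros
        (segment-All 2 (n ∸ 1) λ t 2<t → n≤0⇒n≡0 (conj-≤ decr 0 (<-≤-trans (≰⇒> 3≰μ1) 2<t))))) λ ()
      ... | no μ1≰3  | _       = contradiction (subst (2 ≤_) nz′≡1 two-columns) λ { (s≤s ()) }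
        where
        two-columns : 2 ≤ nonzeros (segment g 2 (n ∸ 1))
        two-columns = subst (λ X → 2 ≤ nonzeros X)
          (sym (trans (segment-uncons g 2 1≤n∸1)
                      (cong (g 3 ∷_) (segment-uncons g 3 (∸-monoˡ-≤ 1 (∸-monoˡ-≤ 1 3≤n))))))
          (nonzeros-≥2 _ (≤-conj decr 1 (s≤s z≤n) (s≤s z≤n) (<⇒≤ (≰⇒> μ1≰3)))
                         (≤-conj decr 1 (s≤s z≤n) (s≤s z≤n) (≰⇒> μ1≰3)))

      μ2≤2 : 2 ≤ length μ → 1 ≤ at μ 2 × at μ 2 ≤ 2
      μ2≤2 2≤len = All-at pos (s≤s z≤n) 2≤len , ≮⇒≥ λ 2<μ2 →
        contradiction (≤-trans (≤-conj decr 2 (s≤s z≤n) (s≤s z≤n) 2<μ2) g3≤1) λ { (s≤s ()) }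
        where
        g3≤1 : g 3 ≤ 1
        g3≤1 = All.head (subst (All (_≤ 1)) (segment-uncons g 2 1≤n∸1) Z′≤1)

      shape : PStar3 n μ × μi ≡ 1
      shape = (((pos , decr) , sum≡n) , μ1≡3 , μ2≤2) , μi≡1

    module Backward (μ1≡3 : at μ 1 ≡ 3) (μ2≤2 : 2 ≤ length μ → 1 ≤ at μ 2 × at μ 2 ≤ 2) (μi≡1 : μi ≡ 1) where

      q≡1 : q ≡ 1
      q≡1 = ≤-antisym (subst (q ≤_) μi≡1 q≤μi) 1≤q

      g3≡1 : g 3 ≡ 1
      g3≡1 = ≤-antisym
        (conj-≤ decr 1 (s≤s (proj₂ (μ2≤2 (≤-trans (s≤s (s≤s z≤n)) j≤len)))))
        (≤-conj decr 1 (s≤s z≤n) (s≤s z≤n) (≤-reflexive (sym μ1≡3)))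

      rest≡0 : All (_≡ 0) (segment g 3 (n ∸ 1 ∸ 1))
      rest≡0 = segment-All 3 _ λ t 3<t → n≤0⇒n≡0 (conj-≤ decr 0 (subst (_< t) (sym μ1≡3) 3<t))

      Z≡3∷0s : Z ≡ g 3 ∷ segment g 3 (n ∸ 1 ∸ 1)
      Z≡3∷0s = trans (Z≡ q≡1 μi≡1) (segment-uncons g 2 1≤n∸1)

      Z≤1 : All (_≤ 1) Z
      Z≤1 = subst (All (_≤ 1)) (sym Z≡3∷0s)
        (≤-reflexive g3≡1 ∷ All.map (λ t≡0 → subst (_≤ 1) (sym t≡0) z≤n) rest≡0)

      nz≡1 : nonzeros Z ≡ 1
      nz≡1 = trans (cong nonzeros Z≡3∷0s)
        (trans (cong (λ x → nonzeros (x ∷ segment g 3 (n ∸ 1 ∸ 1))) g3≡1) (cong suc (nonzeros-zeros rest≡0)))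

  f-shift-≡⇔ : f μ′ ≡ f μ ⇔ (PStar3 n μ × μi ≡ 1)
  f-shift-≡⇔ = mk⇔ to from
    where
    to : f μ′ ≡ f μ → PStar3 n μ × μi ≡ 1
    to fμ′≡fμ with colourSum≡0⇒ B Z (incAt i (incAt i 0̇)) ρ1≡0 E≡0
      where
      ρ1≡0 : incAt i (incAt i 0̇) 1 ≡ 0
      ρ1≡0 = trans (incAt-≢ i (incAt i 0̇) {1} λ ()) (incAt-≢ i 0̇ {1} λ ())
      E≡0 : E ≡ 0
      E≡0 = n≤0⇒n≡0 (+-cancelˡ-≤ (f μ) E 0 (subst (f μ + E ≤_) (trans fμ′≡fμ (sym (+-identityʳ (f μ)))) f-shift-+E))
    ... | nz≡1 , Z≤1 = Forward.shape Z≤1 nz≡1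
    from : PStar3 n μ × μi ≡ 1 → f μ′ ≡ f μ
    from ((_ , μ1≡3 , μ2≤2) , μi≡1) = sym (begin
      f μ                              ≡⟨ colourSum-μ ⟩
      colourSum B (j ∷ suc a ∷ Z) 0̇    ≡⟨ colourSum-shift-≡ B Z a<b j≤len Z≤1 nz≡1 ⟩
      colourSum B (suc b ∷ i ∷ Z) 0̇    ≡⟨ colourSum-μ′ ⟨
      f μ′                             ∎)
      where
      open ≡-Reasoning
      open Backward μ1≡3 μ2≤2 μi≡1 using (Z≤1; nz≡1)

proposition3p5 : (n : ℕ) (μ : List ℕ) (i j : ℕ) → μ ⊢ n →
    2 ≤ i → i < j → j ≤ length μ →
    at μ (i ∸ 1) > at μ i →
    (j < length μ → at μ j > at μ (suc j)) →
    f μ ≤ f (shift μ i j) × (f (shift μ i j) ≡ f μ ⇔ (PStar3 n μ × at μ i ≡ 1))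
proposition3p5 n μ (suc (suc a)) (suc (suc b)) ((pos , decr) , sum≡n) _ (s≤s (s≤s a<b)) j≤len μi<μi-1 μj+1<μj =
  f-shift-≥ , f-shift-≡⇔
  where open ShiftComparison n μ a b pos decr sum≡n a<b j≤len μi<μi-1 μj+1<μj
proposition3p5 n μ (suc zero) _ _ (s≤s ()) _ _ _ _
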